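{- Let $n\ge 0$ and let $\mathbf{v}=(v_0,v_1,\dots,v_n)$ be a tuple of positive integers. For a prime power $q$ let $V_q(\mathbf{v})$ be the set of pairs $(F,G)$ of polynomials in $\mathbb{F}_q[T]$ such that $G=\prod_{i=1}^n P_i^{v_i}$ and $F=P_{n+1}$, where $P_1,\dots,P_{n+1}$ are monic irreducible polynomials with $\deg(P_k)=v_0\prod_{i=1}^{k-1}(v_i+1)$ for $k=1,\dots,n+1$. Then: (i) if $(F,G)\in V_2(\mathbf{v})$ and $v_0=1$, then $\varphi(F)=\sigma(G)$; (ii) if $(F,G)\in V_3(\mathbf{v})$ and $v_0=2$, then $\varphi(TF)=\sigma(T(T+1)G)$.
   Context: For a nonzero $A\in\mathbb{F}_q[T]$ let $|A|=q^{\deg A}$. A "prime" means a monic irreducible polynomial, and $v_P(F)$ is the exponent of the prime $P$ in $F$. For nonzero $F\in\mathbb{F}_q[T]$, $\varphi(F)=\prod_{P\mid F}|P|^{v_P(F)-1}(|P|-1)$, the product over primes dividing $F$, and $\sigma(G)=\sum_{D\mid G}|D|$, the sum over monic divisors $D$ of $G$. -}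

module Defs where

open import Data.Nat using (ℕ; zero; suc; _+_; _*_; _∸_; _^_; _≤_)
open import Data.Nat.DivMod using (_%_; m%n<n)
open import Data.Fin using (Fin; zero; suc; toℕ; fromℕ<; fromℕ; inject₁)
open import Data.List using (List; []; _∷_; [_]; _++_; map; foldr; take; allFin)
open import Data.Nat.ListAction using (sum; product)
open import Data.Vec using (Vec; []; _∷_; toList; lookup)
open import Data.Product using (Σ; _×_; _,_; proj₁; ∃)
open import Data.Sum using (_⊎_)
open import Relation.Binary.PropositionalEquality using (_≡_)
open import Relation.Nullary using (¬_)
open import Function.Bundles using (_⇔_)
open import Data.List.Membership.Propositional using (_∈_)
open import Data.List.Relation.Unary.Unique.Propositional using (Unique)
open import Data.List.Relation.Unary.All using (All)

-- The polynomial ring (ℤ/qℤ)[T] for q = k + 2.  For q prime (we only use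
-- q = 2 and q = 3) this is 𝔽_q[T].

module PolyRing (k : ℕ) where

  q : ℕ
  q = suc (suc k)

  Fq : Set
  Fq = Fin q

  _+F_ : Fq → Fq → Fq
  a +F b = fromℕ< (m%n<n (toℕ a + toℕ b) q)

  _*F_ : Fq → Fq → Fq
  a *F b = fromℕ< (m%n<n (toℕ a * toℕ b) q)

  -- raw coefficient lists, little-endian (coefficient of T^0 first)
  addL : List Fq → List Fq → List Fq
  addL [] ys = ys
  addL (x ∷ xs) [] = x ∷ xs
  addL (x ∷ xs) (y ∷ ys) = (x +F y) ∷ addL xs ys

  scaleL : Fq → List Fq → List Fq
  scaleL c = map (c *F_)

  mulL : List Fq → List Fq → List Fq
  mulL [] ys = []
  mulL (x ∷ xs) ys = addL (scaleL x ys) (zero ∷ mulL xs ys)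

  -- Canonical representation of polynomials:
  --   0p            is the zero polynomial;
  --   nz d c low    is  (1+c)·T^d + Σ_{i<d} (lookup low i)·T^i,
  -- i.e. the leading coefficient is the nonzero element  suc c  of Fq.
  -- Distinct polynomials have distinct representations, so ≡ is equality.
  data Poly : Set where
    0p : Poly
    nz : (d : ℕ) (c : Fin (suc k)) (low : Vec Fq d) → Poly

  toL : Poly → List Fq
  toL 0p = []
  toL (nz d c low) = toList low ++ [ suc c ]

  fromL : List Fq → Poly
  fromL [] = 0p
  fromL (x ∷ xs) with fromL xs
  ... | nz d c low = nz (suc d) c (x ∷ low)
  ... | 0p with x
  ...   | zero = 0p
  ...   | suc c = nz 0 c []

  infixl 7 _*P_
  _*P_ : Poly → Poly → Poly
  A *P B = fromL (mulL (toL A) (toL B))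

  one : Poly
  one = nz 0 zero []

  T : Poly
  T = nz 1 zero (zero ∷ [])

  T+1 : Poly
  T+1 = nz 1 zero (suc zero ∷ [])

  _^P_ : Poly → ℕ → Poly
  A ^P zero = one
  A ^P suc e = A *P (A ^P e)

  prodP : List Poly → Poly
  prodP = foldr _*P_ one

  -- degree (deg 0 is set to 0; only used on nonzero polynomials)
  deg : Poly → ℕ
  deg 0p = 0
  deg (nz d _ _) = d

  -- |A| = q ^ deg A  (only meaningful for A ≠ 0)
  ∣_∣ : Poly → ℕ
  ∣ A ∣ = q ^ deg A

  data Monic : Poly → Set where
    monic : ∀ d low → Monic (nz d zero low)

  data IsUnit : Poly → Set where
    unit : ∀ c → IsUnit (nz 0 c [])

  _∣P_ : Poly → Poly → Set
  D ∣P G = ∃ λ H → D *P H ≡ G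

  Prime : Poly → Set
  Prime P = Monic P × (¬ IsUnit P) × (∀ A B → A *P B ≡ P → IsUnit A ⊎ IsUnit B)

  Val : Poly → Poly → ℕ → Set
  Val P F e = (P ^P e) ∣P F × ¬ ((P ^P suc e) ∣P F)

  -- φ(F) = x : x is the product, over the primes P ∣ F, of
  -- |P|^(v_P(F)-1) (|P|-1).  L lists the primes dividing F (each exactly
  -- once) together with their valuations.
  IsPhi : Poly → ℕ → Set
  IsPhi F x = Σ (List (Poly × ℕ)) λ L →
      Unique (map proj₁ L)
    × (∀ P → (P ∈ map proj₁ L) ⇔ (Prime P × P ∣P F))
    × All (λ { (P , e) → Val P F e }) L
    × x ≡ product (map (λ { (P , e) → ∣ P ∣ ^ (e ∸ 1) * (∣ P ∣ ∸ 1) }) L)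

  IsSigma : Poly → ℕ → Set
  IsSigma G y = Σ (List Poly) λ L →
      Unique L
    × (∀ D → (D ∈ L) ⇔ (Monic D × D ∣P G))
    × y ≡ sum (map ∣_∣ L)

  -- φ(F) = σ(G): the two (well-defined) values exist and coincide.
  PhiEqSigma : Poly → Poly → Set
  PhiEqSigma F G = (Σ ℕ λ x → IsPhi F x × IsSigma G x)
                 × (∀ x y → IsPhi F x → IsSigma G y → x ≡ y)

  -- (F , G) ∈ V_q(v) for v = (v0 , v_1 , … , v_n), vs = (v_1 , … , v_n).
  -- P j  (j : Fin (n+1)) plays the role of P_{j+1}.
  InV : (n v0 : ℕ) (vs : Vec ℕ n) → Poly → Poly → Set
  InV n v0 vs F G = Σ (Fin (suc n) → Poly) λ P →
      (∀ j → Prime (P j))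
    × (∀ j → deg (P j) ≡ v0 * product (map suc (take (toℕ j) (toList vs))))
    × G ≡ prodP (map (λ i → P (inject₁ i) ^P lookup vs i) (allFin n))
    × F ≡ P (fromℕ n)

module F2 = PolyRing 0
module F3 = PolyRing 1

module Submission where

-- For (F , G) ∈ V_q(v) the primes P₁, …, P_{n+1} are pairwise distinct (their
-- degrees strictly increase because every v_i ≥ 1), hence
--   σ(G) = ∏_{i ≤ n} (1 + |P_i| + … + |P_i|^{v_i})   and   φ(P) = |P| - 1.
-- Since |P_{k+1}| = |P_k|^{v_k + 1}, writing |P_k| = a_k + 1 gives
-- a_{k+1} = a_k (1 + |P_k| + … + |P_k|^{v_k}), so by induction along the chain
--   |P_{n+1}| - 1 = (q^{v₀} - 1) · σ(G).
-- (i)  q = 2, v₀ = 1:  φ(F) = |F| - 1 = σ(G).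
-- (ii) q = 3, v₀ = 2:  φ(T F) = 2 (|F| - 1) = 16 σ(G) = σ(T) σ(T+1) σ(G).

open import Defs
open import Data.Nat using (ℕ; zero; suc; _+_; _*_; _^_; _∸_; _≤_; _<_; z≤n; s≤s; _<?_; >-nonZero)
open import Data.Nat.Properties
open import Data.Nat.DivMod using (_%_; m%n<n; m%n%n≡m%n; %-distribˡ-+; %-distribˡ-*; m<n⇒m%n≡m; m*n%n≡0)
open import Data.Nat.ListAction using (sum; product)
open import Data.Nat.ListAction.Properties using (sum-↭; product-↭; sum-++)
import Data.Nat.Tactic.RingSolver as ℕ-Solver
open import Data.Fin using (Fin; zero; suc; toℕ; fromℕ<; fromℕ; inject₁)
open import Data.Fin.Properties using (toℕ-fromℕ<; toℕ-injective; toℕ<n; toℕ-fromℕ)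
open import Data.List using (List; []; _∷_; [_]; _++_; map; length; take; allFin; tabulate)
open import Data.List.Properties using (map-++; length-map; length-++; map-tabulate)
open import Data.List.Relation.Unary.Any using (here; there)
open import Data.List.Relation.Unary.All using ([]; _∷_) renaming (All to ListAll)
import Data.List.Relation.Unary.All as ListAll
import Data.List.Relation.Unary.All.Properties as AllP
open import Data.List.Relation.Unary.AllPairs using ([]; _∷_)
open import Data.List.Relation.Unary.Unique.Propositional using (Unique)
import Data.List.Relation.Unary.Unique.Propositional.Properties as UniqueP
open import Data.List.Membership.Propositional using (_∈_; _∉_)
open import Data.List.Membership.Propositional.Properties using (∈-∃++; ∈-++⁺ˡ; ∈-++⁺ʳ; ∈-++⁻; ∈-map⁺; ∈-map⁻)
open import Data.List.Relation.Binary.Permutation.Propositional using (_↭_; refl; prep; ↭-sym; ↭-trans)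
import Data.List.Relation.Binary.Permutation.Propositional.Properties as PermP
open import Data.Vec using (Vec; []; _∷_; toList; lookup; replicate)
open import Data.Vec.Properties using (length-toList)
open import Data.Vec.Relation.Unary.All using (All; []; _∷_)
open import Data.Product using (Σ; _×_; _,_; proj₁; proj₂)
open import Data.Sum using (_⊎_; inj₁; inj₂)
open import Data.Unit using (⊤)
open import Data.Empty using (⊥-elim)
open import Data.Maybe using (nothing)
open import Function using (_∘_; id)
open import Function.Bundles using (mk⇔; Equivalence)
open import Relation.Nullary using (¬_; Dec; yes; no)
open import Relation.Binary.Definitions using (tri<; tri≈; tri>)
open import Relation.Binary.PropositionalEquality hiding ([_])
import Algebra.Structures as Structures
open import Algebra.Bundles using (CommutativeRing)
import Algebra.Properties.Ring as RingProperties
open import Tactic.RingSolver using (solve-∀)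
open import Tactic.RingSolver.Core.AlmostCommutativeRing using (AlmostCommutativeRing; fromCommutativeRing)

module Residues (k : ℕ) where

  open PolyRing k using (q; Fq; _+F_; _*F_)

  residue : ℕ → Fq
  residue m = fromℕ< (m%n<n m q)

  toℕ-residue : ∀ m → toℕ (residue m) ≡ m % q
  toℕ-residue m = toℕ-fromℕ< (m%n<n m q)

  residue-cong : ∀ m n → m % q ≡ n % q → residue m ≡ residue n
  residue-cong m n e = toℕ-injective (trans (toℕ-residue m) (trans e (sym (toℕ-residue n))))

  residue-toℕ : ∀ a → residue (toℕ a) ≡ a
  residue-toℕ a = toℕ-injective (trans (toℕ-residue (toℕ a)) (m<n⇒m%n≡m (toℕ<n a)))

  reduceˡ-+ : ∀ m n → (toℕ (residue m) + n) % q ≡ (m + n) % q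
  reduceˡ-+ m n = begin
    (toℕ (residue m) + n) % q ≡⟨ cong (λ x → (x + n) % q) (toℕ-residue m) ⟩
    (m % q + n) % q           ≡⟨ %-distribˡ-+ (m % q) n q ⟩
    (m % q % q + n % q) % q   ≡⟨ cong (λ x → (x + n % q) % q) (m%n%n≡m%n m q) ⟩
    (m % q + n % q) % q       ≡⟨ %-distribˡ-+ m n q ⟨
    (m + n) % q               ∎
    where open ≡-Reasoning

  reduceʳ-+ : ∀ m n → (m + toℕ (residue n)) % q ≡ (m + n) % q
  reduceʳ-+ m n = begin
    (m + toℕ (residue n)) % q ≡⟨ cong (_% q) (+-comm m _) ⟩
    (toℕ (residue n) + m) % q ≡⟨ reduceˡ-+ n m ⟩
    (n + m) % q               ≡⟨ cong (_% q) (+-comm n m) ⟩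
    (m + n) % q               ∎
    where open ≡-Reasoning

  reduceˡ-* : ∀ m n → (toℕ (residue m) * n) % q ≡ (m * n) % q
  reduceˡ-* m n = begin
    (toℕ (residue m) * n) % q ≡⟨ cong (λ x → (x * n) % q) (toℕ-residue m) ⟩
    (m % q * n) % q           ≡⟨ %-distribˡ-* (m % q) n q ⟩
    (m % q % q * (n % q)) % q ≡⟨ cong (λ x → (x * (n % q)) % q) (m%n%n≡m%n m q) ⟩
    (m % q * (n % q)) % q     ≡⟨ %-distribˡ-* m n q ⟨
    (m * n) % q               ∎
    where open ≡-Reasoning

  reduceʳ-* : ∀ m n → (m * toℕ (residue n)) % q ≡ (m * n) % q
  reduceʳ-* m n = begin
    (m * toℕ (residue n)) % q ≡⟨ cong (_% q) (*-comm m _) ⟩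
    (toℕ (residue n) * m) % q ≡⟨ reduceˡ-* n m ⟩
    (n * m) % q               ≡⟨ cong (_% q) (*-comm n m) ⟩
    (m * n) % q               ∎
    where open ≡-Reasoning

  +F-comm : ∀ a b → a +F b ≡ b +F a
  +F-comm a b = cong residue (+-comm (toℕ a) (toℕ b))

  +F-assoc : ∀ a b c → (a +F b) +F c ≡ a +F (b +F c)
  +F-assoc a b c = residue-cong (toℕ (residue (toℕ a + toℕ b)) + toℕ c) (toℕ a + toℕ (residue (toℕ b + toℕ c))) (begin
    (toℕ (residue (toℕ a + toℕ b)) + toℕ c) % q ≡⟨ reduceˡ-+ (toℕ a + toℕ b) (toℕ c) ⟩
    (toℕ a + toℕ b + toℕ c) % q                 ≡⟨ cong (_% q) (+-assoc (toℕ a) (toℕ b) (toℕ c)) ⟩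
    (toℕ a + (toℕ b + toℕ c)) % q               ≡⟨ reduceʳ-+ (toℕ a) (toℕ b + toℕ c) ⟨
    (toℕ a + toℕ (residue (toℕ b + toℕ c))) % q ∎)
    where open ≡-Reasoning

  +F-identityˡ : ∀ a → zero +F a ≡ a
  +F-identityˡ = residue-toℕ

  +F-identityʳ : ∀ a → a +F zero ≡ a
  +F-identityʳ a = trans (+F-comm a zero) (+F-identityˡ a)

  *F-comm : ∀ a b → a *F b ≡ b *F a
  *F-comm a b = cong residue (*-comm (toℕ a) (toℕ b))

  *F-assoc : ∀ a b c → (a *F b) *F c ≡ a *F (b *F c)
  *F-assoc a b c = residue-cong (toℕ (residue (toℕ a * toℕ b)) * toℕ c) (toℕ a * toℕ (residue (toℕ b * toℕ c))) (begin
    (toℕ (residue (toℕ a * toℕ b)) * toℕ c) % q ≡⟨ reduceˡ-* (toℕ a * toℕ b) (toℕ c) ⟩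
    (toℕ a * toℕ b * toℕ c) % q                 ≡⟨ cong (_% q) (*-assoc (toℕ a) (toℕ b) (toℕ c)) ⟩
    (toℕ a * (toℕ b * toℕ c)) % q               ≡⟨ reduceʳ-* (toℕ a) (toℕ b * toℕ c) ⟨
    (toℕ a * toℕ (residue (toℕ b * toℕ c))) % q ∎)
    where open ≡-Reasoning

  *F-identityˡ : ∀ a → suc zero *F a ≡ a
  *F-identityˡ a = trans (cong residue (+-identityʳ (toℕ a))) (residue-toℕ a)

  *F-identityʳ : ∀ a → a *F suc zero ≡ a
  *F-identityʳ a = trans (*F-comm a (suc zero)) (*F-identityˡ a)

  *F-zeroˡ : ∀ a → zero *F a ≡ zero
  *F-zeroˡ a = refl

  *F-zeroʳ : ∀ a → a *F zero ≡ zero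
  *F-zeroʳ a = trans (*F-comm a zero) (*F-zeroˡ a)

  *F-distribˡ : ∀ a b c → a *F (b +F c) ≡ (a *F b) +F (a *F c)
  *F-distribˡ a b c =
    residue-cong (toℕ a * toℕ (residue (toℕ b + toℕ c))) (toℕ (residue (toℕ a * toℕ b)) + toℕ (residue (toℕ a * toℕ c))) (begin
      (toℕ a * toℕ (residue (toℕ b + toℕ c))) % q                         ≡⟨ reduceʳ-* (toℕ a) (toℕ b + toℕ c) ⟩
      (toℕ a * (toℕ b + toℕ c)) % q                                       ≡⟨ cong (_% q) (*-distribˡ-+ (toℕ a) (toℕ b) (toℕ c)) ⟩
      (toℕ a * toℕ b + toℕ a * toℕ c) % q                                 ≡⟨ reduceʳ-+ (toℕ a * toℕ b) (toℕ a * toℕ c) ⟨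
      (toℕ a * toℕ b + toℕ (residue (toℕ a * toℕ c))) % q                 ≡⟨ reduceˡ-+ (toℕ a * toℕ b) _ ⟨
      (toℕ (residue (toℕ a * toℕ b)) + toℕ (residue (toℕ a * toℕ c))) % q ∎)
    where open ≡-Reasoning

  *F-distribʳ : ∀ a b c → (a +F b) *F c ≡ (a *F c) +F (b *F c)
  *F-distribʳ a b c = trans (*F-comm (a +F b) c) (trans (*F-distribˡ c a b) (cong₂ _+F_ (*F-comm c a) (*F-comm c b)))

  -- q - 1 plays the role of -1
  -1F : Fq
  -1F = fromℕ (suc k)

  +F-inverse : ∀ a → a +F (-1F *F a) ≡ zero
  +F-inverse a = residue-cong (toℕ a + toℕ (residue (toℕ -1F * toℕ a))) 0 (begin
    (toℕ a + toℕ (residue (toℕ -1F * toℕ a))) % q ≡⟨ reduceʳ-+ (toℕ a) _ ⟩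
    (toℕ a + toℕ -1F * toℕ a) % q                 ≡⟨ cong (λ x → (toℕ a + x * toℕ a) % q) (toℕ-fromℕ (suc k)) ⟩
    (q * toℕ a) % q                               ≡⟨ cong (_% q) (*-comm q (toℕ a)) ⟩
    (toℕ a * q) % q                               ≡⟨ m*n%n≡0 (toℕ a) q ⟩
    0                                             ∎)
    where open ≡-Reasoning

  Inverses : Set
  Inverses = ∀ (c : Fin (suc k)) → Σ Fq λ b → suc c *F b ≡ suc zero

𝔽₂-inverses : Residues.Inverses 0
𝔽₂-inverses zero = suc zero , refl

𝔽₃-inverses : Residues.Inverses 1
𝔽₃-inverses zero = suc zero , refl
𝔽₃-inverses (suc zero) = suc (suc zero) , refl

-- Two duplicate-free lists with the same members are permutations of each
-- other, so sums and products over them agree; this gives uniqueness of the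
-- values of σ and φ, which Defs specify through such lists.
module SameElements {A : Set} where

  all≢⇒∉ : ∀ {x : A} {xs} → ListAll (x ≢_) xs → x ∉ xs
  all≢⇒∉ (p ∷ ps) (here refl) = p refl
  all≢⇒∉ (p ∷ ps) (there m) = all≢⇒∉ ps m

  unique-remove : ∀ (as bs : List A) x → Unique (as ++ x ∷ bs) → Unique (as ++ bs) × x ∉ (as ++ bs)
  unique-remove [] bs x (px ∷ u) = u , all≢⇒∉ px
  unique-remove (a ∷ as) bs x (pa ∷ u) with unique-remove as bs x u
  ... | u' , x∉ = (AllP.++⁺ (AllP.++⁻ˡ as pa) (ListAll.tail (AllP.++⁻ʳ as pa)) ∷ u') , λ
    { (here refl) → ListAll.head (AllP.++⁻ʳ as pa) refl
    ; (there m) → x∉ m }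

  SameMembers : List A → List A → Set
  SameMembers xs ys = (∀ z → z ∈ xs → z ∈ ys) × (∀ z → z ∈ ys → z ∈ xs)

  same-members⇒↭ : ∀ xs ys → Unique xs → Unique ys → SameMembers xs ys → xs ↭ ys
  same-members⇒↭ [] [] ux uy same = refl
  same-members⇒↭ [] (y ∷ ys) ux uy (_ , ys⊆) with ys⊆ y (here refl)
  ... | ()
  same-members⇒↭ (x ∷ xs) ys (px ∷ ux) uy (xs⊆ , ys⊆) with ∈-∃++ (xs⊆ x (here refl))
  ... | as , bs , refl with unique-remove as bs x uy
  ... | uy' , x∉ =
    ↭-trans (prep x (same-members⇒↭ xs (as ++ bs) ux uy' (to , from))) (↭-sym (PermP.shift x as bs))
    where
    to : ∀ z → z ∈ xs → z ∈ as ++ bs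
    to z m with ∈-++⁻ as (xs⊆ z (there m))
    ... | inj₁ m₁ = ∈-++⁺ˡ m₁
    ... | inj₂ (here refl) = ⊥-elim (all≢⇒∉ px m)
    ... | inj₂ (there m₂) = ∈-++⁺ʳ as m₂
    from : ∀ z → z ∈ as ++ bs → z ∈ xs
    from z m with ys⊆ z (∈-++⁺ (∈-++⁻ as m))
      where
      ∈-++⁺ : z ∈ as ⊎ z ∈ bs → z ∈ as ++ x ∷ bs
      ∈-++⁺ (inj₁ m₁) = ∈-++⁺ˡ m₁
      ∈-++⁺ (inj₂ m₂) = ∈-++⁺ʳ as (there m₂)
    ... | here refl = ⊥-elim (x∉ m)
    ... | there m' = m'

  same-sum : ∀ (f : A → ℕ) xs ys → Unique xs → Unique ys → SameMembers xs ys → sum (map f xs) ≡ sum (map f ys)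
  same-sum f xs ys ux uy same = sum-↭ (PermP.map⁺ f (same-members⇒↭ xs ys ux uy same))

  same-product : ∀ (f : A → ℕ) xs ys → Unique xs → Unique ys → SameMembers xs ys → product (map f xs) ≡ product (map f ys)
  same-product f xs ys ux uy same = product-↭ (PermP.map⁺ f (same-members⇒↭ xs ys ux uy same))

module PolyTheory (k : ℕ) (inverse : Residues.Inverses k) where

  open PolyRing k public
  open Residues k

  0≢suc : ∀ {d} → zero ≢ Fin.suc {suc k} d
  0≢suc ()

  inverse⁺ : ∀ c → Σ (Fin (suc k)) λ b → suc c *F suc b ≡ suc zero
  inverse⁺ c with inverse c
  ... | suc b , hb = b , hb
  ... | zero , hb = ⊥-elim (0≢suc (trans (sym (*F-zeroʳ (suc c))) hb))

  *F-nonzero : ∀ (c d : Fin (suc k)) → Σ (Fin (suc k)) λ e → suc c *F suc d ≡ suc e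
  *F-nonzero c d with suc c *F suc d in eq
  ... | suc e = e , refl
  ... | zero = ⊥-elim (0≢suc (begin
    zero                      ≡⟨ *F-zeroʳ (suc b) ⟨
    suc b *F zero             ≡⟨ cong (suc b *F_) eq ⟨
    suc b *F (suc c *F suc d) ≡⟨ *F-assoc (suc b) (suc c) (suc d) ⟨
    (suc b *F suc c) *F suc d ≡⟨ cong (_*F suc d) (trans (*F-comm (suc b) (suc c)) (proj₂ (inverse⁺ c))) ⟩
    suc zero *F suc d         ≡⟨ *F-identityˡ (suc d) ⟩
    suc d                     ∎))
    where
    open ≡-Reasoning
    b = proj₁ (inverse⁺ c)

  -- Coefficient lists are compared coefficientwise, i.e. up to trailing zeros.
  coef : ℕ → List Fq → Fq
  coef i [] = zero
  coef zero (x ∷ xs) = x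
  coef (suc i) (x ∷ xs) = coef i xs

  infix 4 _≈_
  record _≈_ (xs ys : List Fq) : Set where
    constructor mk≈
    field at : ∀ i → coef i xs ≡ coef i ys
  open _≈_ public

  ≈-refl : ∀ {xs} → xs ≈ xs
  ≈-refl = mk≈ λ i → refl

  ≈-sym : ∀ {xs ys} → xs ≈ ys → ys ≈ xs
  ≈-sym e = mk≈ λ i → sym (at e i)

  ≈-trans : ∀ {xs ys zs} → xs ≈ ys → ys ≈ zs → xs ≈ zs
  ≈-trans e f = mk≈ λ i → trans (at e i) (at f i)

  ≈-∷ : ∀ {x y xs ys} → x ≡ y → xs ≈ ys → (x ∷ xs) ≈ (y ∷ ys)
  ≈-∷ e f = mk≈ λ { zero → e ; (suc i) → at f i }

  ≈-tail : ∀ {x y xs ys} → (x ∷ xs) ≈ (y ∷ ys) → xs ≈ ys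
  ≈-tail e = mk≈ λ i → at e (suc i)

  zeros-tail : ∀ {x xs} → [] ≈ (x ∷ xs) → [] ≈ xs
  zeros-tail e = mk≈ λ i → at e (suc i)

  module ≈-Reasoning where
    infix  1 begin_
    infixr 2 _≈⟨_⟩_
    infix  3 _∎
    begin_ : ∀ {xs ys} → xs ≈ ys → xs ≈ ys
    begin e = e
    _≈⟨_⟩_ : ∀ xs {ys zs} → xs ≈ ys → ys ≈ zs → xs ≈ zs
    xs ≈⟨ e ⟩ f = ≈-trans e f
    _∎ : ∀ xs → xs ≈ xs
    xs ∎ = ≈-refl

  coef-add : ∀ i xs ys → coef i (addL xs ys) ≡ coef i xs +F coef i ys
  coef-add i [] ys = sym (+F-identityˡ (coef i ys))
  coef-add i (x ∷ xs) [] = sym (+F-identityʳ (coef i (x ∷ xs)))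
  coef-add zero (x ∷ xs) (y ∷ ys) = refl
  coef-add (suc i) (x ∷ xs) (y ∷ ys) = coef-add i xs ys

  coef-scale : ∀ i c xs → coef i (scaleL c xs) ≡ c *F coef i xs
  coef-scale i c [] = sym (*F-zeroʳ c)
  coef-scale zero c (x ∷ xs) = refl
  coef-scale (suc i) c (x ∷ xs) = coef-scale i c xs

  add-coefwise : ∀ a b c d → (∀ i → coef i a +F coef i b ≡ coef i c +F coef i d) → addL a b ≈ addL c d
  add-coefwise a b c d h = mk≈ λ i → trans (coef-add i a b) (trans (h i) (sym (coef-add i c d)))

  add-cong : ∀ {a b c d} → a ≈ b → c ≈ d → addL a c ≈ addL b d
  add-cong {a} {b} {c} {d} e f = add-coefwise a c b d λ i → cong₂ _+F_ (at e i) (at f i)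

  add-comm : ∀ a b → addL a b ≈ addL b a
  add-comm a b = add-coefwise a b b a λ i → +F-comm (coef i a) (coef i b)

  add-assoc : ∀ a b c → addL (addL a b) c ≈ addL a (addL b c)
  add-assoc a b c = mk≈ λ i → begin
    coef i (addL (addL a b) c)         ≡⟨ coef-add i (addL a b) c ⟩
    coef i (addL a b) +F coef i c      ≡⟨ cong (_+F coef i c) (coef-add i a b) ⟩
    (coef i a +F coef i b) +F coef i c ≡⟨ +F-assoc (coef i a) (coef i b) (coef i c) ⟩
    coef i a +F (coef i b +F coef i c) ≡⟨ cong (coef i a +F_) (coef-add i b c) ⟨
    coef i a +F coef i (addL b c)      ≡⟨ coef-add i a (addL b c) ⟨
    coef i (addL a (addL b c))         ∎
    where open ≡-Reasoning

  add-left-comm : ∀ a b c → addL a (addL b c) ≈ addL b (addL a c)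
  add-left-comm a b c = begin
    addL a (addL b c) ≈⟨ ≈-sym (add-assoc a b c) ⟩
    addL (addL a b) c ≈⟨ add-cong (add-comm a b) (≈-refl {c}) ⟩
    addL (addL b a) c ≈⟨ add-assoc b a c ⟩
    addL b (addL a c) ∎
    where open ≈-Reasoning

  add-interchange : ∀ a b c d → addL (addL a b) (addL c d) ≈ addL (addL a c) (addL b d)
  add-interchange a b c d = begin
    addL (addL a b) (addL c d) ≈⟨ add-assoc a b (addL c d) ⟩
    addL a (addL b (addL c d)) ≈⟨ add-cong (≈-refl {a}) (add-left-comm b c d) ⟩
    addL a (addL c (addL b d)) ≈⟨ ≈-sym (add-assoc a c (addL b d)) ⟩
    addL (addL a c) (addL b d) ∎
    where open ≈-Reasoning

  add-zeros : ∀ a b → [] ≈ b → addL a b ≈ a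
  add-zeros a b e = mk≈ λ i →
    trans (coef-add i a b) (trans (cong (coef i a +F_) (sym (at e i))) (+F-identityʳ (coef i a)))

  scale-add : ∀ c a b → scaleL c (addL a b) ≈ addL (scaleL c a) (scaleL c b)
  scale-add c a b = mk≈ λ i → begin
    coef i (scaleL c (addL a b))               ≡⟨ coef-scale i c (addL a b) ⟩
    c *F coef i (addL a b)                     ≡⟨ cong (c *F_) (coef-add i a b) ⟩
    c *F (coef i a +F coef i b)                ≡⟨ *F-distribˡ c (coef i a) (coef i b) ⟩
    (c *F coef i a) +F (c *F coef i b)         ≡⟨ cong₂ _+F_ (coef-scale i c a) (coef-scale i c b) ⟨
    coef i (scaleL c a) +F coef i (scaleL c b) ≡⟨ coef-add i (scaleL c a) (scaleL c b) ⟨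
    coef i (addL (scaleL c a) (scaleL c b))    ∎
    where open ≡-Reasoning

  add-scale : ∀ c d a → scaleL (c +F d) a ≈ addL (scaleL c a) (scaleL d a)
  add-scale c d a = mk≈ λ i → begin
    coef i (scaleL (c +F d) a)                 ≡⟨ coef-scale i (c +F d) a ⟩
    (c +F d) *F coef i a                       ≡⟨ *F-distribʳ c d (coef i a) ⟩
    (c *F coef i a) +F (d *F coef i a)         ≡⟨ cong₂ _+F_ (coef-scale i c a) (coef-scale i d a) ⟨
    coef i (scaleL c a) +F coef i (scaleL d a) ≡⟨ coef-add i (scaleL c a) (scaleL d a) ⟨
    coef i (addL (scaleL c a) (scaleL d a))    ∎
    where open ≡-Reasoning

  scale-scale : ∀ c d a → scaleL c (scaleL d a) ≈ scaleL (c *F d) a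
  scale-scale c d a = mk≈ λ i → begin
    coef i (scaleL c (scaleL d a)) ≡⟨ coef-scale i c (scaleL d a) ⟩
    c *F coef i (scaleL d a)       ≡⟨ cong (c *F_) (coef-scale i d a) ⟩
    c *F (d *F coef i a)           ≡⟨ *F-assoc c d (coef i a) ⟨
    (c *F d) *F coef i a           ≡⟨ coef-scale i (c *F d) a ⟨
    coef i (scaleL (c *F d) a)     ∎
    where open ≡-Reasoning

  scale-zero : ∀ a → scaleL zero a ≈ []
  scale-zero a = mk≈ λ i → trans (coef-scale i zero a) (*F-zeroˡ (coef i a))

  scale-one : ∀ a → scaleL (suc zero) a ≈ a
  scale-one a = mk≈ λ i → trans (coef-scale i (suc zero) a) (*F-identityˡ (coef i a))

  add-inverse : ∀ a → addL a (scaleL -1F a) ≈ []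
  add-inverse a = mk≈ λ i →
    trans (coef-add i a (scaleL -1F a)) (trans (cong (coef i a +F_) (coef-scale i -1F a)) (+F-inverse (coef i a)))

  -- multiplication by T (consing a zero) commutes with the list operations
  shift-add : ∀ a b → (zero ∷ addL a b) ≈ addL (zero ∷ a) (zero ∷ b)
  shift-add a b = ≈-∷ (sym (+F-identityˡ zero)) ≈-refl

  shift-scale : ∀ c a → (zero ∷ scaleL c a) ≈ scaleL c (zero ∷ a)
  shift-scale c a = ≈-∷ (sym (*F-zeroʳ c)) ≈-refl

  shift-zeros : ∀ {a} → [] ≈ a → [] ≈ (zero ∷ a)
  shift-zeros e = mk≈ λ { zero → refl ; (suc i) → at e i }

  mul-zeroʳ : ∀ a → mulL a [] ≈ []
  mul-zeroʳ [] = ≈-refl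
  mul-zeroʳ (x ∷ a) = ≈-sym (shift-zeros (≈-sym (mul-zeroʳ a)))

  mul-shiftˡ : ∀ a b → mulL (zero ∷ a) b ≈ (zero ∷ mulL a b)
  mul-shiftˡ a b =
    ≈-trans (add-comm (scaleL zero b) (zero ∷ mulL a b)) (add-zeros (zero ∷ mulL a b) (scaleL zero b) (≈-sym (scale-zero b)))

  mul-zerosˡ : ∀ a b → [] ≈ a → mulL a b ≈ []
  mul-zerosˡ [] b e = ≈-refl
  mul-zerosˡ (x ∷ a) b e with at e zero
  ... | refl = ≈-trans (mul-shiftˡ a b) (≈-sym (shift-zeros (≈-sym (mul-zerosˡ a b (zeros-tail e)))))

  mul-congˡ : ∀ {a a'} b → a ≈ a' → mulL a b ≈ mulL a' b
  mul-congˡ {[]} {a'} b e = ≈-sym (mul-zerosˡ a' b e)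
  mul-congˡ {x ∷ a} {[]} b e = mul-zerosˡ (x ∷ a) b (≈-sym e)
  mul-congˡ {x ∷ a} {x' ∷ a'} b e with at e zero
  ... | refl = add-cong ≈-refl (≈-∷ refl (mul-congˡ {a} {a'} b (≈-tail e)))

  mul-distribʳ : ∀ a b c → mulL (addL a b) c ≈ addL (mulL a c) (mulL b c)
  mul-distribʳ [] b c = ≈-refl
  mul-distribʳ (x ∷ a) [] c = ≈-sym (add-zeros (mulL (x ∷ a) c) [] ≈-refl)
  mul-distribʳ (x ∷ a) (y ∷ b) c = begin
    addL (scaleL (x +F y) c) (zero ∷ mulL (addL a b) c)
      ≈⟨ add-cong (add-scale x y c) (≈-∷ refl (mul-distribʳ a b c)) ⟩
    addL (addL (scaleL x c) (scaleL y c)) (zero ∷ addL (mulL a c) (mulL b c))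
      ≈⟨ add-cong (≈-refl {addL (scaleL x c) (scaleL y c)}) (shift-add (mulL a c) (mulL b c)) ⟩
    addL (addL (scaleL x c) (scaleL y c)) (addL (zero ∷ mulL a c) (zero ∷ mulL b c))
      ≈⟨ add-interchange (scaleL x c) (scaleL y c) (zero ∷ mulL a c) (zero ∷ mulL b c) ⟩
    addL (addL (scaleL x c) (zero ∷ mulL a c)) (addL (scaleL y c) (zero ∷ mulL b c))
      ∎
    where open ≈-Reasoning

  mul-scaleˡ : ∀ c a b → mulL (scaleL c a) b ≈ scaleL c (mulL a b)
  mul-scaleˡ c [] b = ≈-refl
  mul-scaleˡ c (x ∷ a) b = begin
    addL (scaleL (c *F x) b) (zero ∷ mulL (scaleL c a) b)
      ≈⟨ add-cong (≈-sym (scale-scale c x b)) (≈-∷ refl (mul-scaleˡ c a b)) ⟩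
    addL (scaleL c (scaleL x b)) (zero ∷ scaleL c (mulL a b))
      ≈⟨ add-cong (≈-refl {scaleL c (scaleL x b)}) (shift-scale c (mulL a b)) ⟩
    addL (scaleL c (scaleL x b)) (scaleL c (zero ∷ mulL a b))
      ≈⟨ ≈-sym (scale-add c (scaleL x b) (zero ∷ mulL a b)) ⟩
    scaleL c (addL (scaleL x b) (zero ∷ mulL a b))
      ∎
    where open ≈-Reasoning

  mul-assoc : ∀ a b c → mulL (mulL a b) c ≈ mulL a (mulL b c)
  mul-assoc [] b c = ≈-refl
  mul-assoc (x ∷ a) b c = begin
    mulL (addL (scaleL x b) (zero ∷ mulL a b)) c
      ≈⟨ mul-distribʳ (scaleL x b) (zero ∷ mulL a b) c ⟩
    addL (mulL (scaleL x b) c) (mulL (zero ∷ mulL a b) c)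
      ≈⟨ add-cong (mul-scaleˡ x b c) (mul-shiftˡ (mulL a b) c) ⟩
    addL (scaleL x (mulL b c)) (zero ∷ mulL (mulL a b) c)
      ≈⟨ add-cong (≈-refl {scaleL x (mulL b c)}) (≈-∷ refl (mul-assoc a b c)) ⟩
    addL (scaleL x (mulL b c)) (zero ∷ mulL a (mulL b c))
      ∎
    where open ≈-Reasoning

  mul-consʳ : ∀ a y b → mulL a (y ∷ b) ≈ addL (scaleL y a) (zero ∷ mulL a b)
  mul-consʳ [] y b = shift-zeros ≈-refl
  mul-consʳ (x ∷ a) y b = begin
    addL (scaleL x (y ∷ b)) (zero ∷ mulL a (y ∷ b))
      ≈⟨ add-cong (≈-refl {scaleL x (y ∷ b)}) (≈-∷ refl (mul-consʳ a y b)) ⟩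
    ((x *F y) +F zero) ∷ addL (scaleL x b) (addL (scaleL y a) (zero ∷ mulL a b))
      ≈⟨ ≈-∷ (cong (_+F zero) (*F-comm x y)) (add-left-comm (scaleL x b) (scaleL y a) (zero ∷ mulL a b)) ⟩
    ((y *F x) +F zero) ∷ addL (scaleL y a) (addL (scaleL x b) (zero ∷ mulL a b))
      ∎
    where open ≈-Reasoning

  mul-comm : ∀ a b → mulL a b ≈ mulL b a
  mul-comm [] b = ≈-sym (mul-zeroʳ b)
  mul-comm (x ∷ a) b = ≈-trans (add-cong ≈-refl (≈-∷ refl (mul-comm a b))) (≈-sym (mul-consʳ b x a))

  mul-congʳ : ∀ a {b b'} → b ≈ b' → mulL a b ≈ mulL a b'
  mul-congʳ a {b} {b'} e = ≈-trans (mul-comm a b) (≈-trans (mul-congˡ a e) (mul-comm b' a))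

  mul-oneˡ : ∀ b → mulL (suc zero ∷ []) b ≈ b
  mul-oneˡ b = ≈-trans (add-zeros (scaleL (suc zero) b) (zero ∷ []) (shift-zeros ≈-refl)) (scale-one b)

  -- Normalisation: fromL is a left inverse of toL and respects ≈, so Poly is
  -- the quotient of coefficient lists by ≈.
  cons : Fq → Poly → Poly
  cons x (nz d c low) = nz (suc d) c (x ∷ low)
  cons zero 0p = 0p
  cons (suc c) 0p = nz 0 c []

  fromL-∷ : ∀ x xs → fromL (x ∷ xs) ≡ cons x (fromL xs)
  fromL-∷ x xs with fromL xs
  ... | nz d c low = refl
  ... | 0p with x
  ...   | zero = refl
  ...   | suc c = refl

  fromL-zeros : ∀ {ys} → [] ≈ ys → fromL ys ≡ 0p
  fromL-zeros {[]} e = refl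
  fromL-zeros {y ∷ ys} e with at e zero
  ... | refl = trans (fromL-∷ zero ys) (cong (cons zero) (fromL-zeros {ys} (zeros-tail e)))

  fromL-cong : ∀ {xs ys} → xs ≈ ys → fromL xs ≡ fromL ys
  fromL-cong {[]} e = sym (fromL-zeros e)
  fromL-cong {x ∷ xs} {[]} e = fromL-zeros (≈-sym e)
  fromL-cong {x ∷ xs} {y ∷ ys} e =
    trans (fromL-∷ x xs) (trans (cong₂ cons (at e zero) (fromL-cong {xs} {ys} (≈-tail e))) (sym (fromL-∷ y ys)))

  toL-cons : ∀ x A → toL (cons x A) ≈ (x ∷ toL A)
  toL-cons x (nz d c low) = ≈-refl
  toL-cons zero 0p = mk≈ λ { zero → refl ; (suc i) → refl }
  toL-cons (suc c) 0p = ≈-refl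

  toL-fromL : ∀ xs → toL (fromL xs) ≈ xs
  toL-fromL [] = ≈-refl
  toL-fromL (x ∷ xs) rewrite fromL-∷ x xs = ≈-trans (toL-cons x (fromL xs)) (≈-∷ refl (toL-fromL xs))

  fromL-toL : ∀ A → fromL (toL A) ≡ A
  fromL-toL 0p = refl
  fromL-toL (nz d c low) = go low
    where
    go : ∀ {d} (low : Vec Fq d) → fromL (toList low ++ [ suc c ]) ≡ nz d c low
    go [] = refl
    go (x ∷ low) = trans (fromL-∷ x (toList low ++ [ suc c ])) (cong (cons x) (go low))

  infixl 6 _+P_
  _+P_ : Poly → Poly → Poly
  A +P B = fromL (addL (toL A) (toL B))

  -P_ : Poly → Poly
  -P A = fromL (scaleL -1F (toL A))

  +P-comm : ∀ A B → A +P B ≡ B +P A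
  +P-comm A B = fromL-cong (add-comm (toL A) (toL B))

  +P-assoc : ∀ A B C → (A +P B) +P C ≡ A +P (B +P C)
  +P-assoc A B C = fromL-cong (begin
    addL (toL (A +P B)) (toL C)         ≈⟨ add-cong (toL-fromL (addL (toL A) (toL B))) (≈-refl {toL C}) ⟩
    addL (addL (toL A) (toL B)) (toL C) ≈⟨ add-assoc (toL A) (toL B) (toL C) ⟩
    addL (toL A) (addL (toL B) (toL C)) ≈⟨ add-cong (≈-refl {toL A}) (≈-sym (toL-fromL (addL (toL B) (toL C)))) ⟩
    addL (toL A) (toL (B +P C))         ∎)
    where open ≈-Reasoning

  +P-identityˡ : ∀ A → 0p +P A ≡ A
  +P-identityˡ A = fromL-toL A

  +P-identityʳ : ∀ A → A +P 0p ≡ A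
  +P-identityʳ A = trans (+P-comm A 0p) (+P-identityˡ A)

  +P-inverseʳ : ∀ A → A +P (-P A) ≡ 0p
  +P-inverseʳ A =
    fromL-zeros (≈-sym (≈-trans (add-cong (≈-refl {toL A}) (toL-fromL (scaleL -1F (toL A)))) (add-inverse (toL A))))

  *P-comm : ∀ A B → A *P B ≡ B *P A
  *P-comm A B = fromL-cong (mul-comm (toL A) (toL B))

  *P-assoc : ∀ A B C → (A *P B) *P C ≡ A *P (B *P C)
  *P-assoc A B C = fromL-cong (begin
    mulL (toL (A *P B)) (toL C)         ≈⟨ mul-congˡ (toL C) (toL-fromL (mulL (toL A) (toL B))) ⟩
    mulL (mulL (toL A) (toL B)) (toL C) ≈⟨ mul-assoc (toL A) (toL B) (toL C) ⟩
    mulL (toL A) (mulL (toL B) (toL C)) ≈⟨ mul-congʳ (toL A) (≈-sym (toL-fromL (mulL (toL B) (toL C)))) ⟩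
    mulL (toL A) (toL (B *P C))         ∎)
    where open ≈-Reasoning

  *P-identityˡ : ∀ A → one *P A ≡ A
  *P-identityˡ A = trans (fromL-cong (mul-oneˡ (toL A))) (fromL-toL A)

  *P-identityʳ : ∀ A → A *P one ≡ A
  *P-identityʳ A = trans (*P-comm A one) (*P-identityˡ A)

  *P-zeroʳ : ∀ A → A *P 0p ≡ 0p
  *P-zeroʳ A = *P-comm A 0p

  *P-distribʳ : ∀ A B C → (A +P B) *P C ≡ (A *P C) +P (B *P C)
  *P-distribʳ A B C = fromL-cong (begin
    mulL (toL (A +P B)) (toL C)                        ≈⟨ mul-congˡ (toL C) (toL-fromL (addL (toL A) (toL B))) ⟩
    mulL (addL (toL A) (toL B)) (toL C)                ≈⟨ mul-distribʳ (toL A) (toL B) (toL C) ⟩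
    addL (mulL (toL A) (toL C)) (mulL (toL B) (toL C)) ≈⟨ ≈-sym (add-cong (toL-fromL (mulL (toL A) (toL C))) (toL-fromL (mulL (toL B) (toL C)))) ⟩
    addL (toL (A *P C)) (toL (B *P C))                 ∎)
    where open ≈-Reasoning

  *P-distribˡ : ∀ A B C → A *P (B +P C) ≡ (A *P B) +P (A *P C)
  *P-distribˡ A B C = trans (*P-comm A (B +P C)) (trans (*P-distribʳ B C A) (cong₂ _+P_ (*P-comm B A) (*P-comm C A)))

  polyIsCommutativeRing : Structures.IsCommutativeRing {A = Poly} _≡_ _+P_ _*P_ -P_ 0p one
  polyIsCommutativeRing = record
    { isRing = record
      { +-isAbelianGroup = record
        { isGroup = record
          { isMonoid = record
            { isSemigroup = record
              { isMagma = record { isEquivalence = isEquivalence ; ∙-cong = cong₂ _+P_ }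
              ; assoc = +P-assoc }
            ; identity = +P-identityˡ , +P-identityʳ }
          ; inverse = (λ A → trans (+P-comm (-P A) A) (+P-inverseʳ A)) , +P-inverseʳ
          ; ⁻¹-cong = cong -P_ }
        ; comm = +P-comm }
      ; *-cong = cong₂ _*P_
      ; *-assoc = *P-assoc
      ; *-identity = *P-identityˡ , *P-identityʳ
      ; distrib = *P-distribˡ , (λ A B C → *P-distribʳ B C A) }
    ; *-comm = *P-comm }

  polyCommutativeRing : CommutativeRing _ _
  polyCommutativeRing = record { isCommutativeRing = polyIsCommutativeRing }

  R : AlmostCommutativeRing _ _
  R = fromCommutativeRing polyCommutativeRing (λ _ → nothing)

  open RingProperties (CommutativeRing.ring polyCommutativeRing) using (-‿distribˡ-*; -‿distribʳ-*)

  sub-add-cancel : ∀ A M → (A +P (-P M)) +P M ≡ A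
  sub-add-cancel A M =
    trans (+P-assoc A (-P M) M) (trans (cong (A +P_) (trans (+P-comm (-P M) M) (+P-inverseʳ M))) (+P-identityʳ A))

  add-sub-cancel : ∀ U A → (U +P A) +P (-P U) ≡ A
  add-sub-cancel U A = trans (cong (_+P (-P U)) (+P-comm U A)) (cancelʳ A U)
    where
    cancelʳ : ∀ A U → (A +P U) +P (-P U) ≡ A
    cancelʳ A U = trans (+P-assoc A U (-P U)) (trans (cong (A +P_) (+P-inverseʳ U)) (+P-identityʳ A))

  *P-distrib-sub : ∀ A B C → A *P (B +P (-P C)) ≡ A *P B +P (-P (A *P C))
  *P-distrib-sub A B C = trans (*P-distribˡ A B (-P C)) (cong ((A *P B) +P_) (sym (-‿distribʳ-* A C)))

  -- The solver sees _+P_ and _*P_ as the ring operations _⊕_ and _⊗_.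
  open AlmostCommutativeRing R using () renaming (_+_ to _⊕_; _*_ to _⊗_)

  -- Degree and leading coefficient of a product: the top coefficient of a
  -- product of nonzero polynomials is the product of the top coefficients,
  -- which is nonzero because ℤ/qℤ is a field.
  lead : Poly → Fq
  lead 0p = zero
  lead (nz d c low) = suc c

  nz≢0p : ∀ {d c low} → nz d c low ≢ 0p
  nz≢0p ()

  addL-snoc : ∀ u v c → length u ≤ length v → addL u (v ++ [ c ]) ≡ addL u v ++ [ c ]
  addL-snoc [] v c le = refl
  addL-snoc (x ∷ u) (y ∷ v) c (s≤s le) = cong ((x +F y) ∷_) (addL-snoc u v c le)

  length-addL : ∀ u v → length u ≤ length v → length (addL u v) ≡ length v
  length-addL [] v le = refl
  length-addL (x ∷ u) (y ∷ v) (s≤s le) = cong suc (length-addL u v le)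

  mulL-snoc : ∀ xs a ys b → Σ (List Fq) λ zs →
    (mulL (xs ++ [ a ]) (ys ++ [ b ]) ≡ zs ++ [ a *F b ]) × (length zs ≡ length xs + length ys)
  mulL-snoc [] a ys b with scaleL a ys | map-++ (a *F_) ys [ b ] | length-map (a *F_) ys
  ... | [] | e | l rewrite e = [] , cong (_∷ []) (+F-identityʳ (a *F b)) , l
  ... | s ∷ u | e | l rewrite e = (s +F zero) ∷ u , cong ((s +F zero) ∷_) (addL-zeroʳ (u ++ [ a *F b ])) , l
    where
    addL-zeroʳ : ∀ u → addL u [] ≡ u
    addL-zeroʳ [] = refl
    addL-zeroʳ (x ∷ u) = refl
  mulL-snoc (x ∷ xs) a ys b with mulL-snoc xs a ys b
  ... | zs , e , l rewrite e =
    addL (scaleL x (ys ++ [ b ])) (zero ∷ zs) ,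
    addL-snoc (scaleL x (ys ++ [ b ])) (zero ∷ zs) (a *F b) shorter ,
    trans (length-addL (scaleL x (ys ++ [ b ])) (zero ∷ zs) shorter) (cong suc l)
    where
    shorter : length (scaleL x (ys ++ [ b ])) ≤ length (zero ∷ zs)
    shorter = subst₂ _≤_ (sym (trans (length-map (x *F_) (ys ++ [ b ])) (trans (length-++ ys) (+-comm (length ys) 1))))
                (cong suc (sym l)) (s≤s (m≤n+m (length ys) (length xs)))

  fromL-snoc : ∀ zs e → Σ (Vec Fq (length zs)) λ low → fromL (zs ++ [ suc e ]) ≡ nz (length zs) e low
  fromL-snoc [] e = [] , refl
  fromL-snoc (z ∷ zs) e with fromL-snoc zs e
  ... | low , eq = z ∷ low , trans (fromL-∷ z (zs ++ [ suc e ])) (cong (cons z) eq)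

  record NonzeroProduct (P : Poly) (d : ℕ) (top : Fq) : Set where
    constructor nonzero-product
    field
      degree : ℕ
      top-index : Fin (suc k)
      low : Vec Fq degree
      is-nz : P ≡ nz degree top-index low
      degree≡ : degree ≡ d
      top≡ : suc top-index ≡ top

  *P-nz : ∀ d c (low : Vec Fq d) d' c' (low' : Vec Fq d') →
    NonzeroProduct (nz d c low *P nz d' c' low') (d + d') (suc c *F suc c')
  *P-nz d c low d' c' low' with mulL-snoc (toList low) (suc c) (toList low') (suc c') | *F-nonzero c c'
  ... | zs , e , l | f , ef with fromL-snoc zs f
  ... | low'' , eq = nonzero-product (length zs) f low''
    (trans (cong fromL (trans e (cong (λ w → zs ++ [ w ]) ef))) eq)
    (trans l (cong₂ _+_ (length-toList low) (length-toList low'))) (sym ef)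

  *P-nonzero : ∀ A B → A ≢ 0p → B ≢ 0p → A *P B ≢ 0p
  *P-nonzero 0p B a≢0 _ = ⊥-elim (a≢0 refl)
  *P-nonzero (nz d c low) 0p _ b≢0 = ⊥-elim (b≢0 refl)
  *P-nonzero (nz d c low) (nz d' c' low') _ _ = nz≢0p ∘ trans (sym (NonzeroProduct.is-nz (*P-nz d c low d' c' low')))

  deg-*P : ∀ A B → A ≢ 0p → B ≢ 0p → deg (A *P B) ≡ deg A + deg B
  deg-*P 0p B a≢0 _ = ⊥-elim (a≢0 refl)
  deg-*P (nz d c low) 0p _ b≢0 = ⊥-elim (b≢0 refl)
  deg-*P (nz d c low) (nz d' c' low') _ _ = trans (cong deg is-nz) degree≡
    where open NonzeroProduct (*P-nz d c low d' c' low')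

  lead-*P : ∀ A B → A ≢ 0p → B ≢ 0p → lead (A *P B) ≡ lead A *F lead B
  lead-*P 0p B a≢0 _ = ⊥-elim (a≢0 refl)
  lead-*P (nz d c low) 0p _ b≢0 = ⊥-elim (b≢0 refl)
  lead-*P (nz d c low) (nz d' c' low') _ _ = trans (cong lead is-nz) top≡
    where open NonzeroProduct (*P-nz d c low d' c' low')

  shape : ∀ A {d c} → A ≢ 0p → deg A ≡ d → lead A ≡ suc c → Σ (Vec Fq d) λ low → A ≡ nz d c low
  shape 0p a≢0 _ _ = ⊥-elim (a≢0 refl)
  shape (nz d c low) _ refl refl = low , refl

  *P-cancelˡ : ∀ A B C → A ≢ 0p → A *P B ≡ A *P C → B ≡ C
  *P-cancelˡ A B C a≢0 e with B +P (-P C) in eq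
  ... | 0p = trans (sym (sub-add-cancel B C)) (trans (cong (_+P C) eq) (+P-identityˡ C))
  ... | nz d c low = ⊥-elim (*P-nonzero A (nz d c low) a≢0 nz≢0p (begin
    A *P nz d c low         ≡⟨ cong (A *P_) eq ⟨
    A *P (B +P (-P C))      ≡⟨ *P-distrib-sub A B C ⟩
    A *P B +P (-P (A *P C)) ≡⟨ cong (λ z → z +P (-P (A *P C))) e ⟩
    A *P C +P (-P (A *P C)) ≡⟨ +P-inverseʳ (A *P C) ⟩
    0p                      ∎))
    where open ≡-Reasoning

  -- The size of a polynomial (its number of coefficients: deg + 1, or 0 for
  -- the zero polynomial) is the measure for division with remainder.
  size : Poly → ℕ
  size A = length (toL A)

  size-nz : ∀ d c (low : Vec Fq d) → size (nz d c low) ≡ suc d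
  size-nz d c low = trans (length-++ (toList low)) (trans (+-comm (length (toList low)) 1) (cong suc (length-toList low)))

  size-nz≰0 : ∀ d c (low : Vec Fq d) → ¬ size (nz d c low) ≤ 0
  size-nz≰0 d c low le with subst (_≤ 0) (size-nz d c low) le
  ... | ()

  size-deg : ∀ A → A ≢ 0p → size A ≡ suc (deg A)
  size-deg 0p a≢0 = ⊥-elim (a≢0 refl)
  size-deg (nz d c low) _ = size-nz d c low

  size-fromL : ∀ xs → size (fromL xs) ≤ length xs
  size-fromL [] = z≤n
  size-fromL (x ∷ xs) rewrite fromL-∷ x xs = ≤-trans (size-cons x (fromL xs)) (s≤s (size-fromL xs))
    where
    size-cons : ∀ x A → size (cons x A) ≤ suc (size A)
    size-cons x (nz d c low) = ≤-refl
    size-cons zero 0p = z≤n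
    size-cons (suc c) 0p = ≤-refl

  addL-snoc₂ : ∀ u v a b → length u ≡ length v → addL (u ++ [ a ]) (v ++ [ b ]) ≡ addL u v ++ [ a +F b ]
  addL-snoc₂ [] [] a b e = refl
  addL-snoc₂ (x ∷ u) (y ∷ v) a b e = cong ((x +F y) ∷_) (addL-snoc₂ u v a b (suc-injective e))

  drop-zero : ∀ w → (w ++ [ zero ]) ≈ w
  drop-zero [] = ≈-sym (shift-zeros ≈-refl)
  drop-zero (x ∷ w) = ≈-∷ refl (drop-zero w)

  size-sub-same-lead : ∀ d c (low low' : Vec Fq d) → size (nz d c low +P (-P nz d c low')) ≤ d
  size-sub-same-lead d c low low' = subst (λ z → size z ≤ d) (sym difference) bound
    where
    u = toList low
    v = scaleL -1F (toList low')
    lu : length u ≡ d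
    lu = length-toList low
    lv : length v ≡ d
    lv = trans (length-map (-1F *F_) (toList low')) (length-toList low')
    w = addL u v
    difference : nz d c low +P (-P nz d c low') ≡ fromL w
    difference = begin
      fromL (addL (u ++ [ suc c ]) (toL (fromL (scaleL -1F (toList low' ++ [ suc c ])))))
        ≡⟨ fromL-cong (add-cong (≈-refl {u ++ [ suc c ]}) (toL-fromL (scaleL -1F (toList low' ++ [ suc c ])))) ⟩
      fromL (addL (u ++ [ suc c ]) (scaleL -1F (toList low' ++ [ suc c ])))
        ≡⟨ cong (λ z → fromL (addL (u ++ [ suc c ]) z)) (map-++ (-1F *F_) (toList low') [ suc c ]) ⟩
      fromL (addL (u ++ [ suc c ]) (v ++ [ -1F *F suc c ]))
        ≡⟨ cong fromL (addL-snoc₂ u v (suc c) (-1F *F suc c) (trans lu (sym lv))) ⟩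
      fromL (w ++ [ suc c +F (-1F *F suc c) ])
        ≡⟨ cong (λ z → fromL (w ++ [ z ])) (+F-inverse (suc c)) ⟩
      fromL (w ++ [ zero ])
        ≡⟨ fromL-cong (drop-zero w) ⟩
      fromL w
        ∎
      where open ≡-Reasoning
    bound : size (fromL w) ≤ d
    bound = ≤-trans (size-fromL w) (≤-reflexive (trans (length-addL u v (≤-reflexive (trans lu (sym lv)))) lv))

  record Division (A B : Poly) : Set where
    constructor division
    field
      quo rem : Poly
      eq : A ≡ quo *P B +P rem
      small : size rem < size B

  monomial : ℕ → Fin (suc k) → Poly
  monomial s c = nz s c (replicate s zero)

  -- one step of long division: for M = (lead A / lead B) T^{deg A - deg B}
  -- the polynomial A - M B has degree below that of A
  leading-term-step : ∀ d c (low : Vec Fq d) e c' (low' : Vec Fq e) → e ≤ d →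
    Σ Poly λ M → size (nz d c low +P (-P (M *P nz e c' low'))) ≤ d
  leading-term-step d c low e c' low' e≤d with *F-nonzero c (proj₁ (inverse⁺ c'))
  ... | f , hf = M , subst (λ z → size (A +P (-P z)) ≤ d) (sym (proj₂ MB-shape))
                       (size-sub-same-lead d c low (proj₁ MB-shape))
    where
    A = nz d c low
    B = nz e c' low'
    b = proj₁ (inverse⁺ c')
    M = monomial (d ∸ e) f
    deg-MB : deg (M *P B) ≡ d
    deg-MB = trans (deg-*P M B nz≢0p nz≢0p) (m∸n+n≡m e≤d)
    lead-MB : lead (M *P B) ≡ suc c
    lead-MB = begin
      lead (M *P B)              ≡⟨ lead-*P M B nz≢0p nz≢0p ⟩
      suc f *F suc c'            ≡⟨ cong (_*F suc c') hf ⟨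
      (suc c *F suc b) *F suc c' ≡⟨ *F-assoc (suc c) (suc b) (suc c') ⟩
      suc c *F (suc b *F suc c') ≡⟨ cong (suc c *F_) (trans (*F-comm (suc b) (suc c')) (proj₂ (inverse⁺ c'))) ⟩
      suc c *F suc zero          ≡⟨ *F-identityʳ (suc c) ⟩
      suc c                      ∎
      where open ≡-Reasoning
    MB-shape : Σ (Vec Fq d) λ low'' → M *P B ≡ nz d c low''
    MB-shape = shape (M *P B) (*P-nonzero M B nz≢0p nz≢0p) deg-MB lead-MB

  -- A - M B = Q B + Rm  gives  A = (Q + M) B + Rm
  division-regroup : ∀ Q M B Rm → (Q ⊗ B ⊕ Rm) ⊕ M ⊗ B ≡ (Q ⊕ M) ⊗ B ⊕ Rm
  division-regroup = solve-∀ R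

  divide-by : ∀ n B → B ≢ 0p → ∀ A → size A ≤ n → Division A B
  divide-by n B b≢0 A le with size A <? size B
  ... | yes lt = division 0p A (sym (+P-identityˡ A)) lt
  divide-by n 0p b≢0 A le | no _ = ⊥-elim (b≢0 refl)
  divide-by n (nz e c' low') b≢0 0p le | no ≮ = ⊥-elim (≮ (subst (1 ≤_) (sym (size-nz e c' low')) (s≤s z≤n)))
  divide-by zero (nz e c' low') b≢0 (nz d c low) le | no ≮ = ⊥-elim (size-nz≰0 d c low le)
  divide-by (suc n) (nz e c' low') b≢0 (nz d c low) le | no ≮ = division (quo +P M) rem eqn small
    where
    A = nz d c low
    B = nz e c' low'
    e≤d : e ≤ d
    e≤d = ≤-pred (subst₂ _≤_ (size-nz e c' low') (size-nz d c low) (≮⇒≥ ≮))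
    M : Poly
    M = proj₁ (leading-term-step d c low e c' low' e≤d)
    rest : Division (A +P (-P (M *P B))) B
    rest = divide-by n B b≢0 (A +P (-P (M *P B)))
             (≤-trans (proj₂ (leading-term-step d c low e c' low' e≤d)) (≤-pred (subst (_≤ suc n) (size-nz d c low) le)))
    open Division rest
    eqn : A ≡ (quo +P M) *P B +P rem
    eqn = trans (sym (sub-add-cancel A (M *P B))) (trans (cong (_+P (M *P B)) eq) (division-regroup quo M B rem))

  divide : ∀ A B → B ≢ 0p → Division A B
  divide A B b≢0 = divide-by (size A) B b≢0 A ≤-refl

  ∣P-combination : ∀ {D B Rm} Q → D ∣P B → D ∣P Rm → D ∣P (Q *P B +P Rm)
  ∣P-combination {D} {B} {Rm} Q (KB , eB) (KR , eR) = Q *P KB +P KR , (begin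
    D *P (Q *P KB +P KR)      ≡⟨ spread Q KB KR D ⟩
    Q *P (D *P KB) +P D *P KR ≡⟨ cong₂ (λ u v → Q *P u +P v) eB eR ⟩
    Q *P B +P Rm              ∎)
    where
    open ≡-Reasoning
    spread : ∀ Q KB KR D → D ⊗ (Q ⊗ KB ⊕ KR) ≡ Q ⊗ (D ⊗ KB) ⊕ D ⊗ KR
    spread = solve-∀ R

  bezout-step : ∀ A B Q Rm D X Y → A ≡ Q *P B +P Rm → D ≡ X *P B +P Y *P Rm → D ≡ Y *P A +P (X +P (-P (Y *P Q))) *P B
  bezout-step A B Q Rm D X Y eA eD = begin
    D                                        ≡⟨ eD ⟩
    X *P B +P Y *P Rm                        ≡⟨ cong (λ z → X *P B +P Y *P z) remainder ⟩
    X *P B +P Y *P (A +P (-P (Q *P B)))      ≡⟨ regroupˡ X Y A B (-P (Q *P B)) ⟩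
    Y *P A +P (X *P B +P Y *P (-P (Q *P B))) ≡⟨ cong (λ z → Y *P A +P (X *P B +P z)) move-neg ⟩
    Y *P A +P (X *P B +P (-P (Y *P Q)) *P B) ≡⟨ regroupʳ X Y A B (-P (Y *P Q)) ⟨
    Y *P A +P (X +P (-P (Y *P Q))) *P B      ∎
    where
    open ≡-Reasoning
    remainder : Rm ≡ A +P (-P (Q *P B))
    remainder = trans (sym (add-sub-cancel (Q *P B) Rm)) (cong (_+P (-P (Q *P B))) (sym eA))
    regroupˡ : ∀ X Y A B N → X ⊗ B ⊕ Y ⊗ (A ⊕ N) ≡ Y ⊗ A ⊕ (X ⊗ B ⊕ Y ⊗ N)
    regroupˡ = solve-∀ R
    regroupʳ : ∀ X Y A B N → Y ⊗ A ⊕ (X ⊕ N) ⊗ B ≡ Y ⊗ A ⊕ (X ⊗ B ⊕ N ⊗ B)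
    regroupʳ = solve-∀ R
    move-neg : Y *P (-P (Q *P B)) ≡ (-P (Y *P Q)) *P B
    move-neg = trans (sym (-‿distribʳ-* Y (Q *P B)))
               (trans (cong -P_ (sym (*P-assoc Y Q B))) (-‿distribˡ-* (Y *P Q) B))

  record Gcd (A B : Poly) : Set where
    field
      D X Y : Poly
      D∣A : D ∣P A
      D∣B : D ∣P B
      bezout : D ≡ X *P A +P Y *P B

  gcd-by : ∀ n A B → size B ≤ n → Gcd A B
  gcd-by n A 0p _ = record
    { D = A ; X = one ; Y = 0p ; D∣A = one , *P-identityʳ A ; D∣B = 0p , *P-zeroʳ A
    ; bezout = sym (trans (cong (_+P 0p) (*P-identityˡ A)) (+P-identityʳ A)) }
  gcd-by zero A (nz d c low) le = ⊥-elim (size-nz≰0 d c low le)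
  gcd-by (suc n) A B@(nz d c low) le = record
    { D = D ; X = Y ; Y = X +P (-P (Y *P Q)) ; D∣B = D∣B
    ; D∣A = subst (D ∣P_) (sym eq) (∣P-combination {D} {B} {Rm} Q D∣B D∣Rm)
    ; bezout = bezout-step A B Q Rm D X Y eq bezout }
    where
    open Division (divide A B nz≢0p) renaming (quo to Q; rem to Rm)
    open Gcd (gcd-by n B Rm (≤-pred (≤-trans small le))) renaming (D∣A to D∣B; D∣B to D∣Rm)

  gcd : ∀ A B → Gcd A B
  gcd A B = gcd-by (size B) A B ≤-refl

  ∣P-trans : ∀ {A B C} → A ∣P B → B ∣P C → A ∣P C
  ∣P-trans {A} (x , e) (y , f) = x *P y , trans (sym (*P-assoc A x y)) (trans (cong (_*P y) e) f)

  size-multiple : ∀ P C {M} → P ≢ 0p → P *P C ≡ M → M ≢ 0p → size P ≤ size M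
  size-multiple P 0p p≢0 e m≢0 = ⊥-elim (m≢0 (trans (sym e) (*P-zeroʳ P)))
  size-multiple P (nz d c low) {M} p≢0 refl m≢0 =
    subst₂ _≤_ (sym (size-deg P p≢0)) (sym (size-deg M m≢0))
      (s≤s (subst (deg P ≤_) (sym (deg-*P P (nz d c low) p≢0 nz≢0p)) (m≤m+n (deg P) d)))

  -- divisibility by a nonzero polynomial is decidable: test the remainder
  dec∣P : ∀ P A → P ≢ 0p → Dec (P ∣P A)
  dec∣P P A p≢0 with divide A P p≢0
  ... | division Q 0p eq _ = yes (Q , trans (*P-comm P Q) (sym (trans eq (+P-identityʳ (Q *P P)))))
  ... | division Q Rm@(nz d c low) eq small =
    no λ { (K , e) → <⇒≱ small (size-multiple P (K +P (-P Q)) p≢0 (sym (remainder K e)) nz≢0p) }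
    where
    remainder : ∀ K → P *P K ≡ A → Rm ≡ P *P (K +P (-P Q))
    remainder K e = begin
      Rm                              ≡⟨ add-sub-cancel (Q *P P) Rm ⟨
      (Q *P P +P Rm) +P (-P (Q *P P)) ≡⟨ cong (_+P (-P (Q *P P))) (trans (sym eq) (sym e)) ⟩
      P *P K +P (-P (Q *P P))         ≡⟨ cong (λ z → P *P K +P (-P z)) (*P-comm Q P) ⟩
      P *P K +P (-P (P *P Q))         ≡⟨ *P-distrib-sub P K Q ⟨
      P *P (K +P (-P Q))              ∎
      where open ≡-Reasoning

  monic-nz : ∀ {A} → Monic A → A ≢ 0p
  monic-nz (monic d low) ()

  monic-lead : ∀ {A} → Monic A → lead A ≡ suc zero
  monic-lead (monic d low) = refl

  lead-monic : ∀ A → A ≢ 0p → lead A ≡ suc zero → Monic A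
  lead-monic 0p a≢0 _ = ⊥-elim (a≢0 refl)
  lead-monic (nz d zero low) _ _ = monic d low

  monic-one : Monic one
  monic-one = monic 0 []

  monic-*P : ∀ {A B} → Monic A → Monic B → Monic (A *P B)
  monic-*P {A} {B} mA mB = lead-monic (A *P B) (*P-nonzero A B (monic-nz mA) (monic-nz mB))
    (trans (lead-*P A B (monic-nz mA) (monic-nz mB)) (cong₂ _*F_ (monic-lead mA) (monic-lead mB)))

  monic-quotient : ∀ {A B} → Monic A → Monic (A *P B) → Monic B
  monic-quotient {A} {0p} mA mAB = ⊥-elim (monic-nz mAB (*P-zeroʳ A))
  monic-quotient {A} {B@(nz d c low)} mA mAB = lead-monic B nz≢0p (begin
    suc c             ≡⟨ *F-identityˡ (suc c) ⟨
    suc zero *F suc c ≡⟨ cong (_*F suc c) (monic-lead mA) ⟨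
    lead A *F lead B  ≡⟨ lead-*P A B (monic-nz mA) nz≢0p ⟨
    lead (A *P B)     ≡⟨ monic-lead mAB ⟩
    suc zero          ∎)
    where open ≡-Reasoning

  ^P-+ : ∀ A m n → A ^P (m + n) ≡ (A ^P m) *P (A ^P n)
  ^P-+ A zero n = sym (*P-identityˡ (A ^P n))
  ^P-+ A (suc m) n = trans (cong (A *P_) (^P-+ A m n)) (sym (*P-assoc A (A ^P m) (A ^P n)))

  deg-divisor-one : ∀ A H → A *P H ≡ one → deg A ≡ 0
  deg-divisor-one 0p H e = refl
  deg-divisor-one A@(nz d c low) 0p e = ⊥-elim (nz≢0p (trans (sym e) (*P-zeroʳ A)))
  deg-divisor-one A@(nz d c low) B@(nz d' c' low') e =
    m+n≡0⇒m≡0 d (trans (sym (deg-*P A B nz≢0p nz≢0p)) (cong deg e))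

  monic-∣-one : ∀ {D} → Monic D → D ∣P one → D ≡ one
  monic-∣-one {D} mD (H , e) with deg-divisor-one D H e
  monic-∣-one (monic zero []) (H , e) | refl = refl

  prime-nz : ∀ {P} → Prime P → P ≢ 0p
  prime-nz pP = monic-nz (proj₁ pP)

  prime-deg : ∀ {P} → Prime P → 1 ≤ deg P
  prime-deg (monic zero [] , not-unit , _) = ⊥-elim (not-unit (unit zero))
  prime-deg (monic (suc d) low , _ , _) = s≤s z≤n

  prime-∤-one : ∀ {P} → Prime P → ¬ (P ∣P one)
  prime-∤-one {P} pP (H , e) = <⇒≢ (prime-deg pP) (sym (deg-divisor-one P H e))

  deg1-prime : ∀ {P} → Monic P → deg P ≡ 1 → Prime P
  deg1-prime {nz 1 zero low} (monic .1 .low) refl = monic 1 low , (λ ()) , irreducible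
    where
    irreducible : ∀ A B → A *P B ≡ nz 1 zero low → IsUnit A ⊎ IsUnit B
    irreducible 0p B e = ⊥-elim (nz≢0p (sym e))
    irreducible A@(nz d c l) 0p e = ⊥-elim (nz≢0p (trans (sym e) (*P-zeroʳ A)))
    irreducible (nz zero c []) (nz d' c' l') e = inj₁ (unit c)
    irreducible (nz (suc d) c l) (nz zero c' []) e = inj₂ (unit c')
    irreducible A@(nz (suc d) c l) B@(nz (suc d') c' l') e =
      ⊥-elim (2+n≢1 (trans (sym (+-suc (suc d) d')) (trans (sym (deg-*P A B nz≢0p nz≢0p)) (cong deg e))))
      where
      2+n≢1 : ∀ {n} → suc (suc n) ≢ 1
      2+n≢1 ()

  unit-inverse : ∀ c → Σ Poly λ V → nz 0 c [] *P V ≡ one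
  unit-inverse c = nz 0 b [] , product-is-one
    where
    b = proj₁ (inverse⁺ c)
    C = nz 0 c []
    B = nz 0 b []
    product-is-one : C *P B ≡ one
    product-is-one with shape (C *P B) (*P-nonzero C B nz≢0p nz≢0p) (deg-*P C B nz≢0p nz≢0p)
                                (trans (lead-*P C B nz≢0p nz≢0p) (proj₂ (inverse⁺ c)))
    ... | [] , e = e

  Coprime : Poly → Poly → Set
  Coprime C D = Σ Poly λ X → Σ Poly λ Y → X *P C +P Y *P D ≡ one

  Coprime-sym : ∀ {C D} → Coprime C D → Coprime D C
  Coprime-sym {C} {D} (X , Y , e) = Y , X , trans (+P-comm (Y *P D) (X *P C)) e

  coprime-∣ : ∀ {C D} W → Coprime C D → D ∣P (C *P W) → D ∣P W
  coprime-∣ {C} {D} W (X , Y , e) (K , eK) = X *P K +P Y *P W , (begin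
    D *P (X *P K +P Y *P W)        ≡⟨ spread D X K Y W ⟩
    X *P (D *P K) +P (Y *P D) *P W ≡⟨ cong (λ z → X *P z +P (Y *P D) *P W) eK ⟩
    X *P (C *P W) +P (Y *P D) *P W ≡⟨ collect X C W Y D ⟩
    (X *P C +P Y *P D) *P W        ≡⟨ cong (_*P W) e ⟩
    one *P W                       ≡⟨ *P-identityˡ W ⟩
    W                              ∎)
    where
    open ≡-Reasoning
    spread : ∀ D X K Y W → D ⊗ (X ⊗ K ⊕ Y ⊗ W) ≡ X ⊗ (D ⊗ K) ⊕ (Y ⊗ D) ⊗ W
    spread = solve-∀ R
    collect : ∀ X C W Y D → X ⊗ (C ⊗ W) ⊕ (Y ⊗ D) ⊗ W ≡ (X ⊗ C ⊕ Y ⊗ D) ⊗ W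
    collect = solve-∀ R

  -- a prime is coprime to everything it does not divide: the gcd of P and A
  -- divides P, so it is a unit or P itself
  prime-coprime : ∀ {P} A → Prime P → ¬ (P ∣P A) → Coprime P A
  prime-coprime {P} A (_ , _ , irreducible) P∤A with gcd P A
  ... | g with Gcd.D∣A g
  ... | H , DH≡P with irreducible (Gcd.D g) H DH≡P
  ... | inj₂ (unit c) = ⊥-elim (P∤A (∣P-trans {P} P∣D (Gcd.D∣B g)))
    where
    V = proj₁ (unit-inverse c)
    P∣D : P ∣P Gcd.D g
    P∣D = V , (begin
      P *P V              ≡⟨ cong (_*P V) DH≡P ⟨
      (Gcd.D g *P H) *P V ≡⟨ *P-assoc (Gcd.D g) H V ⟩
      Gcd.D g *P (H *P V) ≡⟨ cong (Gcd.D g *P_) (proj₂ (unit-inverse c)) ⟩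
      Gcd.D g *P one      ≡⟨ *P-identityʳ (Gcd.D g) ⟩
      Gcd.D g             ∎)
      where open ≡-Reasoning
  ... | inj₁ (unit c) = U *P Gcd.X g , U *P Gcd.Y g , (begin
    (U *P Gcd.X g) *P P +P (U *P Gcd.Y g) *P A ≡⟨ distribute U (Gcd.X g) P (Gcd.Y g) A ⟨
    U *P (Gcd.X g *P P +P Gcd.Y g *P A)        ≡⟨ cong (U *P_) (Gcd.bezout g) ⟨
    U *P nz 0 c []                             ≡⟨ *P-comm U (nz 0 c []) ⟩
    nz 0 c [] *P U                             ≡⟨ proj₂ (unit-inverse c) ⟩
    one                                        ∎)
    where
    open ≡-Reasoning
    U = proj₁ (unit-inverse c)
    distribute : ∀ U X P Y A → U ⊗ (X ⊗ P ⊕ Y ⊗ A) ≡ (U ⊗ X) ⊗ P ⊕ (U ⊗ Y) ⊗ A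
    distribute = solve-∀ R

  euclid : ∀ {P} A B → Prime P → P ∣P (A *P B) → P ∣P A ⊎ P ∣P B
  euclid {P} A B pP P∣AB with dec∣P P A (prime-nz pP)
  ... | yes P∣A = inj₁ P∣A
  ... | no P∤A = inj₂ (coprime-∣ {A} {P} B (Coprime-sym {P} {A} (prime-coprime A pP P∤A)) P∣AB)

  coprime-∣-^P : ∀ {Q D} → Prime Q → ¬ (Q ∣P D) → ∀ m H → D ∣P ((Q ^P m) *P H) → D ∣P H
  coprime-∣-^P pQ Q∤D zero H (K , e) = K , trans e (*P-identityˡ H)
  coprime-∣-^P {Q} {D} pQ Q∤D (suc m) H D∣ =
    coprime-∣-^P pQ Q∤D m H (coprime-∣ {Q} {D} ((Q ^P m) *P H) (prime-coprime D pQ Q∤D)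
      (subst (D ∣P_) (*P-assoc Q (Q ^P m) H) D∣))

  prime-∣-prime : ∀ {Q P} → Prime Q → Prime P → Q ∣P P → Q ≡ P
  prime-∣-prime {Q} {P} pQ pP@(_ , _ , irreducible) (H , e) with irreducible Q H e
  ... | inj₁ Q-unit = ⊥-elim (proj₁ (proj₂ pQ) Q-unit)
  ... | inj₂ (unit c) with lead-one
    where
    lead-one : suc c ≡ suc zero
    lead-one = begin
      suc c                      ≡⟨ *F-identityˡ (suc c) ⟨
      suc zero *F suc c          ≡⟨ cong (_*F suc c) (monic-lead (proj₁ pQ)) ⟨
      lead Q *F lead (nz 0 c []) ≡⟨ lead-*P Q (nz 0 c []) (prime-nz pQ) nz≢0p ⟨
      lead (Q *P nz 0 c [])      ≡⟨ cong lead e ⟩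
      lead P                     ≡⟨ monic-lead (proj₁ pP) ⟩
      suc zero                   ∎
      where open ≡-Reasoning
  ... | refl = trans (sym (*P-identityʳ Q)) e

  prime-∣-^P : ∀ {P Q} → Prime P → Prime Q → ∀ w → P ∣P (Q ^P w) → P ≡ Q
  prime-∣-^P pP pQ zero P∣1 = ⊥-elim (prime-∤-one pP P∣1)
  prime-∣-^P {P} {Q} pP pQ (suc w) P∣ with euclid Q (Q ^P w) pP P∣
  ... | inj₁ P∣Q = prime-∣-prime pP pQ P∣Q
  ... | inj₂ P∣Qʷ = prime-∣-^P pP pQ w P∣Qʷ

  -- Products of powers of distinct primes.  A list ((Q₁ , w₁) ∷ …) stands for
  -- Q₁^{w₁} ⋯; it is admissible when the Q_i are pairwise distinct primes.
  PrimePowers : Set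
  PrimePowers = List (Poly × ℕ)

  expand : PrimePowers → Poly
  expand [] = one
  expand ((Q , w) ∷ ps) = (Q ^P w) *P expand ps

  DistinctPrimes : PrimePowers → Set
  DistinctPrimes [] = ⊤
  DistinctPrimes ((Q , w) ∷ ps) = Prime Q × ListAll (λ p → proj₁ p ≢ Q) ps × DistinctPrimes ps

  distinct-prime : ∀ ps → DistinctPrimes ps → ∀ {P} → P ∈ map proj₁ ps → Prime P
  distinct-prime ((Q , w) ∷ ps) (pQ , _ , _) (here refl) = pQ
  distinct-prime ((Q , w) ∷ ps) (_ , _ , dp) (there m) = distinct-prime ps dp m

  distinct-unique : ∀ ps → DistinctPrimes ps → Unique (map proj₁ ps)
  distinct-unique [] _ = []
  distinct-unique ((Q , w) ∷ ps) (_ , others , dp) = AllP.map⁺ (ListAll.map (_∘ sym) others) ∷ distinct-unique ps dp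

  prime-∤-expand : ∀ {Q} ps → Prime Q → ListAll (λ p → proj₁ p ≢ Q) ps → DistinctPrimes ps → ¬ (Q ∣P expand ps)
  prime-∤-expand [] pQ _ _ Q∣ = prime-∤-one pQ Q∣
  prime-∤-expand ((P , v) ∷ ps) pQ (P≢Q ∷ others) (pP , _ , dp) Q∣ with euclid (P ^P v) (expand ps) pQ Q∣
  ... | inj₁ Q∣Pᵛ = P≢Q (sym (prime-∣-^P pQ pP v Q∣Pᵛ))
  ... | inj₂ Q∣rest = prime-∤-expand ps pQ others dp Q∣rest

  prime-∣-expand : ∀ ps → DistinctPrimes ps → ∀ {P} → Prime P → P ∣P expand ps → P ∈ map proj₁ ps
  prime-∣-expand [] _ pP P∣ = ⊥-elim (prime-∤-one pP P∣)
  prime-∣-expand ((Q , w) ∷ ps) (pQ , _ , dp) pP P∣ with euclid (Q ^P w) (expand ps) pP P∣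
  ... | inj₁ P∣Qʷ = here (prime-∣-^P pP pQ w P∣Qʷ)
  ... | inj₂ P∣rest = there (prime-∣-expand ps dp pP P∣rest)

  geometric : ℕ → ℕ → ℕ
  geometric x zero = 1
  geometric x (suc w) = 1 + x * geometric x w

  σ-expand : PrimePowers → ℕ
  σ-expand [] = 1
  σ-expand ((Q , w) ∷ ps) = geometric ∣ Q ∣ w * σ-expand ps

  ∣*P∣ : ∀ A B → A ≢ 0p → B ≢ 0p → ∣ A *P B ∣ ≡ ∣ A ∣ * ∣ B ∣
  ∣*P∣ A B a≢0 b≢0 = trans (cong (q ^_) (deg-*P A B a≢0 b≢0)) (^-distribˡ-+-* q (deg A) (deg B))

  sum-∣Q*∣ : ∀ Q L → Q ≢ 0p → ListAll (_≢ 0p) L → sum (map ∣_∣ (map (Q *P_) L)) ≡ ∣ Q ∣ * sum (map ∣_∣ L)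
  sum-∣Q*∣ Q [] _ _ = sym (*-zeroʳ ∣ Q ∣)
  sum-∣Q*∣ Q (E ∷ L) q≢0 (e≢0 ∷ L≢0) =
    trans (cong₂ _+_ (∣*P∣ Q E q≢0 e≢0) (sum-∣Q*∣ Q L q≢0 L≢0)) (sym (*-distribˡ-+ ∣ Q ∣ ∣ E ∣ (sum (map ∣_∣ L))))

  -- Q^0 L, …, Q^w L: the divisors of Q^w H, given the divisors L of H
  times-powers : Poly → ℕ → List Poly → List Poly
  times-powers Q zero L = L
  times-powers Q (suc w) L = L ++ map (Q *P_) (times-powers Q w L)

  divisors : PrimePowers → List Poly
  divisors [] = one ∷ []
  divisors ((Q , w) ∷ ps) = times-powers Q w (divisors ps)

  module AdjoinPrimePower (Q H : Poly) (pQ : Prime Q) (Q∤H : ¬ (Q ∣P H)) (L : List Poly)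
      (L-sound : ∀ D → D ∈ L → Monic D × D ∣P H) (L-complete : ∀ D → Monic D → D ∣P H → D ∈ L) where

    sound : ∀ w D → D ∈ times-powers Q w L → Monic D × D ∣P ((Q ^P w) *P H)
    sound zero D m with L-sound D m
    ... | mD , (h , e) = mD , h , trans e (sym (*P-identityˡ H))
    sound (suc w) D m with ∈-++⁻ L m
    ... | inj₁ m-L with L-sound D m-L
    ...   | mD , (h , e) = mD , (Q ^P suc w) *P h , (begin
      D *P ((Q ^P suc w) *P h) ≡⟨ *P-assoc D (Q ^P suc w) h ⟨
      (D *P (Q ^P suc w)) *P h ≡⟨ cong (_*P h) (*P-comm D (Q ^P suc w)) ⟩
      ((Q ^P suc w) *P D) *P h ≡⟨ *P-assoc (Q ^P suc w) D h ⟩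
      (Q ^P suc w) *P (D *P h) ≡⟨ cong ((Q ^P suc w) *P_) e ⟩
      (Q ^P suc w) *P H        ∎)
      where open ≡-Reasoning
    sound (suc w) D m | inj₂ m-Q with ∈-map⁻ (Q *P_) m-Q
    ... | E , m-E , refl with sound w E m-E
    ...   | mE , (x , e) = monic-*P (proj₁ pQ) mE , x , (begin
      (Q *P E) *P x        ≡⟨ *P-assoc Q E x ⟩
      Q *P (E *P x)        ≡⟨ cong (Q *P_) e ⟩
      Q *P ((Q ^P w) *P H) ≡⟨ *P-assoc Q (Q ^P w) H ⟨
      (Q ^P suc w) *P H    ∎)
      where open ≡-Reasoning

    -- a monic divisor D of Q^w H is either prime to Q, hence divides H, or
    -- is Q E with E a monic divisor of Q^{w-1} H
    complete : ∀ w D → Monic D → D ∣P ((Q ^P w) *P H) → D ∈ times-powers Q w L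
    complete zero D mD (x , e) = L-complete D mD (x , trans e (*P-identityˡ H))
    complete (suc w) D mD D∣ with dec∣P Q D (prime-nz pQ)
    ... | no Q∤D = ∈-++⁺ˡ (L-complete D mD (coprime-∣-^P pQ Q∤D (suc w) H D∣))
    ... | yes (E , refl) = ∈-++⁺ʳ L (∈-map⁺ (Q *P_) (complete w E (monic-quotient (proj₁ pQ) mD) (x , E∣)))
      where
      x = proj₁ D∣
      E∣ : E *P x ≡ (Q ^P w) *P H
      E∣ = *P-cancelˡ Q (E *P x) ((Q ^P w) *P H) (prime-nz pQ)
             (trans (sym (*P-assoc Q E x)) (trans (proj₂ D∣) (*P-assoc Q (Q ^P w) H)))

    unique : Unique L → ∀ w → Unique (times-powers Q w L)
    unique uL zero = uL
    unique uL (suc w) =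
      UniqueP.++⁺ uL (UniqueP.map⁺ (λ {E} {E'} → *P-cancelˡ Q E E' (prime-nz pQ)) (unique uL w)) disjoint
      where
      -- elements of the second block are divisible by Q, those of L are not
      disjoint : ∀ {v} → ¬ (v ∈ L × v ∈ map (Q *P_) (times-powers Q w L))
      disjoint {v} (m₁ , m₂) with ∈-map⁻ (Q *P_) m₂
      ... | E , _ , refl = Q∤H (∣P-trans {Q} (E , refl) (proj₂ (L-sound v m₁)))

    norm-sum : ∀ w → sum (map ∣_∣ (times-powers Q w L)) ≡ geometric ∣ Q ∣ w * sum (map ∣_∣ L)
    norm-sum zero = sym (*-identityˡ (sum (map ∣_∣ L)))
    norm-sum (suc w) = begin
      sum (map ∣_∣ (L ++ map (Q *P_) (times-powers Q w L)))
        ≡⟨ cong sum (map-++ ∣_∣ L (map (Q *P_) (times-powers Q w L))) ⟩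
      sum (map ∣_∣ L ++ map ∣_∣ (map (Q *P_) (times-powers Q w L)))
        ≡⟨ sum-++ (map ∣_∣ L) (map ∣_∣ (map (Q *P_) (times-powers Q w L))) ⟩
      S + sum (map ∣_∣ (map (Q *P_) (times-powers Q w L)))
        ≡⟨ cong (S +_) (sum-∣Q*∣ Q (times-powers Q w L) (prime-nz pQ) nonzero) ⟩
      S + ∣ Q ∣ * sum (map ∣_∣ (times-powers Q w L))
        ≡⟨ cong (λ z → S + ∣ Q ∣ * z) (norm-sum w) ⟩
      S + ∣ Q ∣ * (geometric ∣ Q ∣ w * S)
        ≡⟨ factor S ∣ Q ∣ (geometric ∣ Q ∣ w) ⟩
      (1 + ∣ Q ∣ * geometric ∣ Q ∣ w) * S
        ∎
      where
      open ≡-Reasoning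
      S = sum (map ∣_∣ L)
      factor : ∀ s x g → s + x * (g * s) ≡ (1 + x * g) * s
      factor = ℕ-Solver.solve-∀
      nonzero : ListAll (_≢ 0p) (times-powers Q w L)
      nonzero = ListAll.tabulate λ {E} m → monic-nz (proj₁ (sound w E m))

  divisors-sound : ∀ ps → DistinctPrimes ps → ∀ D → D ∈ divisors ps → Monic D × D ∣P expand ps
  divisors-complete : ∀ ps → DistinctPrimes ps → ∀ D → Monic D → D ∣P expand ps → D ∈ divisors ps

  module Adjoin (Q : Poly) (w : ℕ) (ps : PrimePowers) (dp : DistinctPrimes ((Q , w) ∷ ps)) =
    AdjoinPrimePower Q (expand ps) (proj₁ dp) (prime-∤-expand ps (proj₁ dp) (proj₁ (proj₂ dp)) (proj₂ (proj₂ dp)))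
      (divisors ps) (divisors-sound ps (proj₂ (proj₂ dp))) (divisors-complete ps (proj₂ (proj₂ dp)))

  divisors-sound [] _ D (here refl) = monic-one , one , *P-identityˡ one
  divisors-sound ((Q , w) ∷ ps) dp = Adjoin.sound Q w ps dp w

  divisors-complete [] _ D mD D∣ = here (monic-∣-one mD D∣)
  divisors-complete ((Q , w) ∷ ps) dp = Adjoin.complete Q w ps dp w

  divisors-unique : ∀ ps → DistinctPrimes ps → Unique (divisors ps)
  divisors-unique [] _ = [] ∷ []
  divisors-unique ((Q , w) ∷ ps) dp = Adjoin.unique Q w ps dp (divisors-unique ps (proj₂ (proj₂ dp))) w

  divisors-norm-sum : ∀ ps → DistinctPrimes ps → sum (map ∣_∣ (divisors ps)) ≡ σ-expand ps
  divisors-norm-sum [] _ = refl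
  divisors-norm-sum ((Q , w) ∷ ps) dp =
    trans (Adjoin.norm-sum Q w ps dp w) (cong (geometric ∣ Q ∣ w *_) (divisors-norm-sum ps (proj₂ (proj₂ dp))))

  σ-value : ∀ ps → DistinctPrimes ps → IsSigma (expand ps) (σ-expand ps)
  σ-value ps dp = divisors ps , divisors-unique ps dp ,
    (λ D → mk⇔ (divisors-sound ps dp D) (λ (mD , D∣) → divisors-complete ps dp D mD D∣)) ,
    sym (divisors-norm-sum ps dp)

  σ-unique : ∀ ps → DistinctPrimes ps → ∀ y → IsSigma (expand ps) y → y ≡ σ-expand ps
  σ-unique ps dp y (L , uL , members , y≡) = trans y≡ (trans (same-sum ∣_∣ L (divisors ps) uL (divisors-unique ps dp)
      ((λ D m → let (mD , D∣) = Equivalence.to (members D) m in divisors-complete ps dp D mD D∣) ,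
       (λ D m → Equivalence.from (members D) (divisors-sound ps dp D m))))
    (divisors-norm-sum ps dp))
    where open SameElements

  -- Valuations are unique, since Q^a ∣ Q^b for a ≤ b.
  ^P-∣-^P : ∀ Q a b → a ≤ b → (Q ^P a) ∣P (Q ^P b)
  ^P-∣-^P Q a b a≤b = Q ^P (b ∸ a) , trans (sym (^P-+ Q a (b ∸ a))) (cong (Q ^P_) (m+[n∸m]≡n a≤b))

  Val-unique : ∀ {Q F e e'} → Val Q F e → Val Q F e' → e ≡ e'
  Val-unique {Q} {F} {e} {e'} (Qᵉ∣ , Qᵉ⁺¹∤) (Qᵉ'∣ , Qᵉ'⁺¹∤) with <-cmp e e'
  ... | tri< e<e' _ _ = ⊥-elim (Qᵉ⁺¹∤ (∣P-trans {Q ^P suc e} (^P-∣-^P Q (suc e) e' e<e') Qᵉ'∣))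
  ... | tri≈ _ e≡e' _ = e≡e'
  ... | tri> _ _ e>e' = ⊥-elim (Qᵉ'⁺¹∤ (∣P-trans {Q ^P suc e'} (^P-∣-^P Q (suc e') e e>e') Qᵉ∣))

  -- Products of distinct primes, the case needed for φ: qs stands for ∏ qs.
  simple : List Poly → PrimePowers
  simple = map (_, 1)

  map-proj₁-simple : ∀ qs → map proj₁ (simple qs) ≡ qs
  map-proj₁-simple [] = refl
  map-proj₁-simple (P ∷ qs) = cong (P ∷_) (map-proj₁-simple qs)

  split-off : ∀ qs → DistinctPrimes (simple qs) → ∀ {P} → P ∈ qs →
    Σ Poly λ F' → (expand (simple qs) ≡ P *P F') × ¬ (P ∣P F')
  split-off (Q ∷ qs) (pQ , others , dp) (here refl) =
    expand (simple qs) , cong (_*P expand (simple qs)) (*P-identityʳ Q) , prime-∤-expand (simple qs) pQ others dp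
  split-off (Q ∷ qs) (pQ , others , dp) {P} (there m) with split-off qs dp m
  ... | F' , e , P∤F' = (Q ^P 1) *P F' , swap-factor e , P∤
    where
    pP : Prime P
    pP = distinct-prime (simple qs) dp (subst (P ∈_) (sym (map-proj₁-simple qs)) m)
    swap-factor : expand (simple qs) ≡ P *P F' → (Q ^P 1) *P expand (simple qs) ≡ P *P ((Q ^P 1) *P F')
    swap-factor e = trans (cong ((Q ^P 1) *P_) e)
      (trans (sym (*P-assoc (Q ^P 1) P F')) (trans (cong (_*P F') (*P-comm (Q ^P 1) P)) (*P-assoc P (Q ^P 1) F')))
    P∤ : ¬ (P ∣P ((Q ^P 1) *P F'))
    P∤ P∣ with euclid (Q ^P 1) F' pP P∣
    ... | inj₁ P∣Q = ListAll.lookup others (∈-map⁺ (_, 1) m) (prime-∣-^P pP pQ 1 P∣Q)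
    ... | inj₂ P∣F' = P∤F' P∣F'

  -- Val speaks of P^1 = P * 1 rather than P
  ∣^P1 : ∀ {P F} → (P ^P 1) ∣P F → P ∣P F
  ∣^P1 {P} (x , e) = one *P x , trans (sym (*P-assoc P one x)) e

  simple-valuation : ∀ qs → DistinctPrimes (simple qs) → ∀ {P} → P ∈ qs → Val P (expand (simple qs)) 1
  simple-valuation qs dp {P} m with split-off qs dp m
  ... | F' , e , P∤F' = (F' , trans (cong (_*P F') (*P-identityʳ P)) (sym e)) , λ (K , eK) → P∤F' (one *P K , divide-out K eK)
    where
    pP : Prime P
    pP = distinct-prime (simple qs) dp (subst (P ∈_) (sym (map-proj₁-simple qs)) m)
    divide-out : ∀ K → (P ^P 2) *P K ≡ expand (simple qs) → P *P (one *P K) ≡ F'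
    divide-out K eK = *P-cancelˡ P (P *P (one *P K)) F' (prime-nz pP)
      (trans (sym (*P-assoc P P (one *P K))) (trans (sym (*P-assoc (P *P P) one K))
        (trans (cong (_*P K) (*P-assoc P P one)) (trans eK e))))

  φ-simple : List Poly → ℕ
  φ-simple qs = product (map (λ P → ∣ P ∣ ^ 0 * (∣ P ∣ ∸ 1)) qs)

  φ-terms : ∀ qs → product (map (λ { (P , e) → ∣ P ∣ ^ (e ∸ 1) * (∣ P ∣ ∸ 1) }) (simple qs)) ≡ φ-simple qs
  φ-terms [] = refl
  φ-terms (P ∷ qs) = cong (∣ P ∣ ^ 0 * (∣ P ∣ ∸ 1) *_) (φ-terms qs)

  φ-value : ∀ qs → DistinctPrimes (simple qs) → IsPhi (expand (simple qs)) (φ-simple qs)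
  φ-value qs dp = simple qs , distinct-unique (simple qs) dp ,
    (λ P → mk⇔ (λ m → distinct-prime (simple qs) dp m ,
                       ∣^P1 {P} (proj₁ (simple-valuation qs dp (subst (P ∈_) (map-proj₁-simple qs) m))))
               (λ (pP , P∣) → prime-∣-expand (simple qs) dp pP P∣)) ,
    AllP.map⁺ (ListAll.tabulate (simple-valuation qs dp)) ,
    sym (φ-terms qs)

  φ-unique : ∀ qs → DistinctPrimes (simple qs) → ∀ x → IsPhi (expand (simple qs)) x → x ≡ φ-simple qs
  φ-unique qs dp x (L , uL , primes , vals , x≡) =
    trans x≡ (trans (same-product _ L (simple qs) (UniqueP.map⁻ uL) (UniqueP.map⁻ (distinct-unique (simple qs) dp)) (L⊆ , ⊆L))
                    (φ-terms qs))
    where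
    open SameElements
    F = expand (simple qs)
    -- an entry (P , e) of L has P among qs, and then e = 1
    L⊆ : ∀ z → z ∈ L → z ∈ simple qs
    L⊆ (P , e) m with Equivalence.to (primes P) (∈-map⁺ proj₁ m)
    ... | pP , P∣ with subst (P ∈_) (map-proj₁-simple qs) (prime-∣-expand (simple qs) dp pP P∣)
    ... | m-qs with Val-unique {P} {F} {e} {1} (ListAll.lookup vals m) (simple-valuation qs dp m-qs)
    ... | refl = ∈-map⁺ (_, 1) m-qs
    ⊆L : ∀ z → z ∈ simple qs → z ∈ L
    ⊆L z m with ∈-map⁻ (_, 1) m
    ... | P , m-qs , refl
        with ∈-map⁻ proj₁ (Equivalence.from (primes P)
               (distinct-prime (simple qs) dp (∈-map⁺ proj₁ m) , ∣^P1 {P} (proj₁ (simple-valuation qs dp m-qs))))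
    ... | (P' , e) , m-L , refl with Val-unique {P} {F} {e} {1} (ListAll.lookup vals m-L) (simple-valuation qs dp m-qs)
    ... | refl = m-L

  φ≡σ : ∀ qs ps F G → DistinctPrimes (simple qs) → F ≡ expand (simple qs) → DistinctPrimes ps → G ≡ expand ps →
        φ-simple qs ≡ σ-expand ps → PhiEqSigma F G
  φ≡σ qs ps F G dq refl dp refl values =
    (φ-simple qs , φ-value qs dq , subst (IsSigma G) (sym values) (σ-value ps dp)) ,
    λ x y φx σy → trans (φ-unique qs dq x φx) (trans values (sym (σ-unique ps dp y σy)))

  degree-separated : ∀ {Q m} (ps : PrimePowers) → deg Q < m → ListAll (λ p → m ≤ deg (proj₁ p)) ps → ListAll (λ p → proj₁ p ≢ Q) ps
  degree-separated {Q} {m} ps degQ<m = ListAll.map λ m≤ P≡Q → <⇒≱ degQ<m (subst (λ z → m ≤ deg z) P≡Q m≤)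

  -- The chain P₀, …, P_n of the set V (indices shifted by one), with
  -- deg P_j = d (v₀+1) ⋯ (v_{j-1}+1), and the factorisation of G it gives.
  chain : ∀ n → Vec ℕ n → (Fin (suc n) → Poly) → PrimePowers
  chain zero [] P = []
  chain (suc n) (v ∷ vs) P = (P zero , v) ∷ chain n vs (P ∘ suc)

  Degrees : ∀ n → ℕ → Vec ℕ n → (Fin (suc n) → Poly) → Set
  Degrees n d vs P = ∀ j → deg (P j) ≡ d * product (map suc (take (toℕ j) (toList vs)))

  degrees-tail : ∀ n d v vs P → Degrees (suc n) d (v ∷ vs) P → Degrees n (d * suc v) vs (P ∘ suc)
  degrees-tail n d v vs P h j = trans (h (suc j)) (sym (*-assoc d (suc v) _))

  degree-head : ∀ n d vs P → Degrees n d vs P → deg (P zero) ≡ d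
  degree-head n d vs P h = trans (h zero) (*-identityʳ d)

  degree-≥ : ∀ n d vs P → Degrees n d vs P → ∀ j → d ≤ deg (P j)
  degree-≥ n d vs P h j = subst (d ≤_) (sym (h j)) (m≤m*n d _ {{>-nonZero (product-pos (take (toℕ j) (toList vs)))}})
    where
    product-pos : ∀ xs → 1 ≤ product (map suc xs)
    product-pos [] = s≤s z≤n
    product-pos (x ∷ xs) = ≤-trans (product-pos xs) (m≤n*m (product (map suc xs)) (suc x))

  chain-degrees : ∀ n d vs P → Degrees n d vs P → ListAll (λ p → d ≤ deg (proj₁ p)) (chain n vs P)
  chain-degrees zero d [] P h = []
  chain-degrees (suc n) d (v ∷ vs) P h = degree-≥ (suc n) d (v ∷ vs) P h zero ∷
    ListAll.map (≤-trans (m≤m*n d (suc v))) (chain-degrees n (d * suc v) vs (P ∘ suc) (degrees-tail n d v vs P h))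

  -- since every v_i ≥ 1 the degrees increase strictly, so the primes differ
  chain-distinct : ∀ n d vs P → 1 ≤ d → All (1 ≤_) vs → (∀ j → Prime (P j)) → Degrees n d vs P →
                   DistinctPrimes (chain n vs P)
  chain-distinct zero d [] P _ _ _ _ = _
  chain-distinct (suc n) d (v ∷ vs) P 1≤d (1≤v ∷ 1≤vs) prime h =
    prime zero ,
    degree-separated (chain n vs (P ∘ suc)) (subst (_< d * suc v) (sym (degree-head (suc n) d (v ∷ vs) P h)) d<d[1+v])
      (chain-degrees n (d * suc v) vs (P ∘ suc) (degrees-tail n d v vs P h)) ,
    chain-distinct n (d * suc v) vs (P ∘ suc) (≤-trans 1≤d (m≤m*n d (suc v))) 1≤vs (prime ∘ suc) (degrees-tail n d v vs P h)
    where
    d<d[1+v] : d < d * suc v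
    d<d[1+v] = m<m*n d (suc v) {{>-nonZero 1≤d}} (s≤s 1≤v)

  chain-expand : ∀ n vs (P : Fin (suc n) → Poly) →
                 prodP (map (λ i → P (inject₁ i) ^P lookup vs i) (allFin n)) ≡ expand (chain n vs P)
  chain-expand n vs P = trans (cong prodP (map-tabulate id (λ i → P (inject₁ i) ^P lookup vs i))) (go n vs P)
    where
    go : ∀ n vs (P : Fin (suc n) → Poly) → prodP (tabulate (λ i → P (inject₁ i) ^P lookup vs i)) ≡ expand (chain n vs P)
    go zero [] P = refl
    go (suc n) (v ∷ vs) P = cong ((P zero ^P v) *P_) (go n vs (P ∘ suc))

  geometric-sum : ∀ a v → a * geometric (suc a) v + 1 ≡ suc a ^ suc v
  geometric-sum a zero = base a
    where
    base : ∀ a → a * 1 + 1 ≡ suc a * 1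
    base = ℕ-Solver.solve-∀
  geometric-sum a (suc v) = trans (unfold a (geometric (suc a) v)) (cong (suc a *_) (geometric-sum a v))
    where
    unfold : ∀ a g → a * (1 + suc a * g) + 1 ≡ suc a * (a * g + 1)
    unfold = ℕ-Solver.solve-∀

  chain-norm : ∀ n d vs P → Degrees n d vs P → ∀ a → q ^ d ≡ suc a → a * σ-expand (chain n vs P) + 1 ≡ ∣ P (fromℕ n) ∣
  chain-norm zero d [] P h a qᵈ≡ = begin
    a * 1 + 1  ≡⟨ cong (_+ 1) (*-identityʳ a) ⟩
    a + 1      ≡⟨ +-comm a 1 ⟩
    suc a      ≡⟨ qᵈ≡ ⟨
    q ^ d      ≡⟨ cong (q ^_) (degree-head zero d [] P h) ⟨
    ∣ P zero ∣ ∎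
    where open ≡-Reasoning
  chain-norm (suc n) d (v ∷ vs) P h a qᵈ≡ = begin
    a * (geometric ∣ P zero ∣ v * σ-rest) + 1 ≡⟨ cong (λ z → a * (geometric z v * σ-rest) + 1) ∣P₀∣ ⟩
    a * (geometric (suc a) v * σ-rest) + 1    ≡⟨ cong (_+ 1) (*-assoc a (geometric (suc a) v) σ-rest) ⟨
    a * geometric (suc a) v * σ-rest + 1      ≡⟨ chain-norm n (d * suc v) vs (P ∘ suc) (degrees-tail n d v vs P h)
                                                       (a * geometric (suc a) v) q^d[1+v] ⟩
    ∣ P (fromℕ (suc n)) ∣ ∎
    where
    open ≡-Reasoning
    σ-rest = σ-expand (chain n vs (P ∘ suc))
    ∣P₀∣ : ∣ P zero ∣ ≡ suc a
    ∣P₀∣ = trans (cong (q ^_) (degree-head (suc n) d (v ∷ vs) P h)) qᵈ≡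
    q^d[1+v] : q ^ (d * suc v) ≡ suc (a * geometric (suc a) v)
    q^d[1+v] = begin
      q ^ (d * suc v)               ≡⟨ ^-*-assoc q d (suc v) ⟨
      (q ^ d) ^ suc v               ≡⟨ cong (_^ suc v) qᵈ≡ ⟩
      suc a ^ suc v                 ≡⟨ geometric-sum a v ⟨
      a * geometric (suc a) v + 1   ≡⟨ +-comm _ 1 ⟩
      suc (a * geometric (suc a) v) ∎

  record ChainFacts (v0 : ℕ) (F G : Poly) : Set where
    field
      factors : PrimePowers
      distinct : DistinctPrimes factors
      G≡ : G ≡ expand factors
      F-prime : Prime F
      F-degree : v0 ≤ deg F
      factor-degrees : ListAll (λ p → v0 ≤ deg (proj₁ p)) factors
      norm : ∀ a → q ^ v0 ≡ suc a → a * σ-expand factors + 1 ≡ ∣ F ∣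

  chain-facts : ∀ n v0 vs F G → 1 ≤ v0 → All (1 ≤_) vs → InV n v0 vs F G → ChainFacts v0 F G
  chain-facts n v0 vs F G 1≤v0 1≤vs (P , prime , degrees , G≡ , F≡) = record
    { factors = chain n vs P
    ; distinct = chain-distinct n v0 vs P 1≤v0 1≤vs prime degrees
    ; G≡ = trans G≡ (chain-expand n vs P)
    ; F-prime = subst Prime (sym F≡) (prime (fromℕ n))
    ; F-degree = subst (λ z → v0 ≤ deg z) (sym F≡) (degree-≥ n v0 vs P degrees (fromℕ n))
    ; factor-degrees = chain-degrees n v0 vs P degrees
    ; norm = λ a e → trans (chain-norm n v0 vs P degrees a e) (cong ∣_∣ (sym F≡)) }

module 𝔽₂ = PolyTheory 0 𝔽₂-inverses
module 𝔽₃ = PolyTheory 1 𝔽₃-inverses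

norm-pred : ∀ a s N → a * s + 1 ≡ N → N ∸ 1 ≡ a * s
norm-pred a s N refl = m+n∸n≡m (a * s) 1

-- (i): over 𝔽₂ with v₀ = 1 one has q^{v₀} - 1 = 1, so φ(F) = |F| - 1 = σ(G)
part-i : ∀ n vs → All (1 ≤_) vs → ∀ F G → F2.InV n 1 vs F G → F2.PhiEqSigma F G
part-i n vs 1≤vs F G inV = φ≡σ (F ∷ []) factors F G (F-prime , [] , _) F≡ distinct G≡ values
  where
  open 𝔽₂
  open ChainFacts (chain-facts n 1 vs F G (s≤s z≤n) 1≤vs inV)
  F≡ : F ≡ expand (simple (F ∷ []))
  F≡ = sym (trans (*P-identityʳ (F *P one)) (*P-identityʳ F))
  values : φ-simple (F ∷ []) ≡ σ-expand factors
  values = begin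
    1 * (∣ F ∣ ∸ 1) * 1  ≡⟨ trans (*-identityʳ _) (*-identityˡ _) ⟩
    ∣ F ∣ ∸ 1            ≡⟨ norm-pred 1 (σ-expand factors) ∣ F ∣ (norm 1 refl) ⟩
    1 * σ-expand factors ≡⟨ *-identityˡ _ ⟩
    σ-expand factors     ∎
    where open ≡-Reasoning

-- (ii): over 𝔽₃ with v₀ = 2 one has q^{v₀} - 1 = 8, so
-- φ(T F) = 2 (|F| - 1) = 16 σ(G) = σ(T) σ(T+1) σ(G) = σ(T (T+1) G)
part-ii : ∀ n vs → All (1 ≤_) vs → ∀ F G → F3.InV n 2 vs F G →
          F3.PhiEqSigma (F3.T F3.*P F) (F3.T F3.*P F3.T+1 F3.*P G)
part-ii n vs 1≤vs F G inV =
  φ≡σ (T ∷ F ∷ []) ((T , 1) ∷ (T+1 , 1) ∷ factors) (T *P F) (T *P T+1 *P G) distinct-TF TF≡ distinct-TT+1G TT+1G≡ values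
  where
  open 𝔽₃
  open ChainFacts (chain-facts n 2 vs F G (s≤s z≤n) 1≤vs inV)
  T-prime : Prime T
  T-prime = deg1-prime (monic 1 _) refl
  T+1-prime : Prime T+1
  T+1-prime = deg1-prime (monic 1 _) refl
  -- T and T+1 have degree 1 while F and the factors of G have degree ≥ 2
  distinct-TF : DistinctPrimes (simple (T ∷ F ∷ []))
  distinct-TF = T-prime , degree-separated ((F , 1) ∷ []) ≤-refl (F-degree ∷ []) , F-prime , [] , _
  distinct-TT+1G : DistinctPrimes ((T , 1) ∷ (T+1 , 1) ∷ factors)
  distinct-TT+1G = T-prime , ((λ ()) ∷ degree-separated factors ≤-refl factor-degrees) ,
                   T+1-prime , degree-separated factors ≤-refl factor-degrees , distinct
  TF≡ : T *P F ≡ expand (simple (T ∷ F ∷ []))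
  TF≡ = sym (cong₂ _*P_ (*P-identityʳ T) (trans (*P-identityʳ (F *P one)) (*P-identityʳ F)))
  TT+1G≡ : T *P T+1 *P G ≡ expand ((T , 1) ∷ (T+1 , 1) ∷ factors)
  TT+1G≡ = trans (*P-assoc T T+1 G) (sym (cong₂ _*P_ (*P-identityʳ T) (cong₂ _*P_ (*P-identityʳ T+1) (sym G≡))))
  values : φ-simple (T ∷ F ∷ []) ≡ σ-expand ((T , 1) ∷ (T+1 , 1) ∷ factors)
  values = begin
    2 * (1 * (∣ F ∣ ∸ 1) * 1) ≡⟨ cong (λ z → 2 * (1 * z * 1)) (norm-pred 8 σ ∣ F ∣ (norm 8 refl)) ⟩
    2 * (1 * (8 * σ) * 1)     ≡⟨ sixteen σ ⟩
    4 * (4 * σ)               ∎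
    where
    open ≡-Reasoning
    σ = σ-expand factors
    sixteen : ∀ s → 2 * (1 * (8 * s) * 1) ≡ 4 * (4 * s)
    sixteen = ℕ-Solver.solve-∀

lemma1p2 : (n v0 : ℕ) (vs : Vec ℕ n) → 1 ≤ v0 → All (1 ≤_) vs →
    (∀ F G → F2.InV n v0 vs F G → v0 ≡ 1 → F2.PhiEqSigma F G)
    × (∀ F G → F3.InV n v0 vs F G → v0 ≡ 2 →
         F3.PhiEqSigma (F3.T F3.*P F) (F3.T F3.*P F3.T+1 F3.*P G))
lemma1p2 n v0 vs _ 1≤vs =
  (λ F G inV v0≡1 → part-i n vs 1≤vs F G (subst (λ v → F2.InV n v vs F G) v0≡1 inV)) ,
  (λ F G inV v0≡2 → part-ii n vs 1≤vs F G (subst (λ v → F3.InV n v vs F G) v0≡2 inV))
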